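{- Let $\mathcal{D}$ be a Ryser design of order $v$, index $\lambda$, replication numbers $r_1>r_2$, having exactly two block sizes $k_1>k_2$. Let $c,d,a,x,y$ be as defined in the context. (a) If $k_1=2\lambda+t_1a$ with $2t_1c+\lambda>e_2$, that is $2t_1>x$, then $\mathcal{D}$ is of Type-1. (b) If $k_2=2\lambda-t_2a$ with $2t_2d+\lambda>e_1$, that is $2t_2>y$, then $\mathcal{D}$ is of Type-1.
   Context: A Ryser design of order $v$ and index $\lambda$ is a pair $(X,L)$ where $X$ is a set of $v$ points and $L$ is a collection of $v$ subsets (blocks) of $X$ such that any two distinct blocks meet in exactly $\lambda$ points, every block has size $>\lambda$, and there exist two blocks of different sizes. It is known that there are integers $r_1>r_2$ with $r_1+r_2=v+1$ such that every point lies in exactly $r_1$ or exactly $r_2$ blocks. Let $e_i$ be the number of points with replication number $r_i$. Write $(r_1-1)/(r_2-1)=c/d$ with $\gcd(c,d)=1$, and $a=c-d$. Every block size has the form $2\lambda+ta$ for an integer $t$. Then $c\mid e_2-\lambda$ and $d\mid e_1-\lambda$; set $x=(e_2-\lambda)/c$ and $y=(e_1-\lambda)/d$, so $e_2=\lambda+xc$, $e_1=\lambda+yd$. A symmetric $(v,k,\mu)$ design is a set of $v$ points with $v$ blocks, each of size $k$, any two distinct blocks meeting in $\mu\ge1$ points, $k>\mu$. Given such a design with block set $\mathcal{A}$ and a fixed block $A$, the collection $\{A\}\cup\{A\triangle B: B\in\mathcal{A}, B\ne A\}$ (when $k\ne2\mu$) is a Ryser design; a Ryser design obtained in this way is of Type-1.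 -}

module Defs where

open import Data.Nat using (ℕ; _+_; _*_; _∸_; _<_; _>_; _≤_; _/_; NonZero)
open import Data.Nat.GCD using (gcd)
open import Data.Fin using (Fin)
open import Data.Fin.Subset using (Subset; _∩_; _∪_; _─_; ∣_∣; inside)
open import Data.Fin.Permutation using (Permutation′; _⟨$⟩ʳ_)
open import Data.Vec using (lookup; tabulate)
open import Data.Bool using (Bool)
open import Data.Nat using (_≟_)
open import Relation.Nullary.Decidable using (⌊_⌋)
open import Relation.Binary.PropositionalEquality using (_≡_; _≢_)
open import Data.Product using (Σ; ∃; ∃-syntax; _×_)
open import Data.Sum using (_⊎_)

Blocks : ℕ → Set
Blocks v = Fin v → Subset v

_△_ : ∀ {n} → Subset n → Subset n → Subset n
A △ B = (A ─ B) ∪ (B ─ A)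

record IsRyser (v λ′ : ℕ) (B : Blocks v) : Set where
  field
    meet      : ∀ i j → i ≢ j → ∣ B i ∩ B j ∣ ≡ λ′
    bigBlocks : ∀ i → λ′ < ∣ B i ∣
    twoSizes  : ∃[ i ] ∃[ j ] ∣ B i ∣ ≢ ∣ B j ∣

record IsSymmetric (v k μ : ℕ) (A : Blocks v) : Set where
  field
    μ≥1   : 1 ≤ μ
    μ<k   : μ < k
    size  : ∀ i → ∣ A i ∣ ≡ k
    meet  : ∀ i j → i ≢ j → ∣ A i ∩ A j ∣ ≡ μ

rep : ∀ {v} → Blocks v → Fin v → ℕ
rep B p = ∣ tabulate (λ i → lookup (B i) p) ∣

numRep : ∀ {v} → Blocks v → ℕ → ℕ
numRep B r = ∣ tabulate (λ p → ⌊ rep B p ≟ r ⌋) ∣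

-- Type-1: up to relabelling of blocks (a permutation σ of block indices),
-- B consists of A j and the A j △ A i (i ≠ j) for a symmetric (v,k,μ)
-- design A with k ≠ 2μ and a fixed block index j.  (Relabelling points is
-- absorbed by relabelling the symmetric design's points.)
IsType1 : ∀ {v} → Blocks v → Set
IsType1 {v} B =
  Σ ℕ λ k → Σ ℕ λ μ → Σ (Blocks v) λ A → Σ (Fin v) λ j → Σ (Permutation′ v) λ σ →
    ( IsSymmetric v k μ A × k ≢ 2 * μ
    × B (σ ⟨$⟩ʳ j) ≡ A j
    × (∀ i → i ≢ j → B (σ ⟨$⟩ʳ i) ≡ A j △ A i) )

module Submission where

-- All counting is done in ℚ with the library's finite sums.
--  * Dual Gram identity ('GramDual'): for a 0/1 matrix N with
--    N Nᵀ = lam J + D (D positive diagonal), Nᵀ D⁻¹ N = I + θ y yᵀ; hence each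
--    replication number is an affine function of a weighted replication y,
--    which separates points inside and outside a block of exceptional size.
--  * Ryser designs have positive index, and the separation lemma applies.
--  * Type-1 criterion: if all blocks but B a have size k, the family
--    {B a} ∪ {B a △ B i} is a symmetric design when k = 2 lam, and otherwise a
--    Ryser design whose replication numbers contradict separation.
--  * Counting with r₁, r₂: a block of size 2 lam + t (c − d) has lam + t c
--    points of replication r₂, so under the theorem's bound only one block
--    has that size, and the Type-1 criterion yields the theorem.

open import Data.Nat as ℕ using (ℕ; zero; suc; z≤n; s≤s)
import Data.Nat.Properties as ℕP
open import Data.Nat.Coprimality using (Coprime)
open import Data.Nat.Divisibility using (_∣0)
open import Data.Integer as ℤ using (ℤ)
import Data.Integer.Properties as ℤP
open import Data.Fin using (Fin; zero; suc; _≟_)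
open import Data.Fin.Properties using (nonZeroIndex)
import Data.Fin.Permutation as Perm
open import Data.Bool using (Bool; true; false; _∧_; _xor_; not; if_then_else_)
open import Data.Vec using ([]; _∷_; lookup; tabulate)
open import Data.Vec.Properties using (lookup∘tabulate; lookup-zipWith; tabulate-cong)
open import Data.Fin.Subset using (Subset; ∣_∣; _∩_)
open import Data.Fin.Subset.Properties using (∣p∣≤n; ∩-comm)
open import Data.Rational as Q using (ℚ; 0ℚ; 1ℚ; _+_; _*_; -_; _-_; _≤_; _<_; 1/_)
open import Data.Rational.Literals using (fromℤ)
import Data.Rational.Properties as QP
import Data.Rational.Unnormalised as U
import Data.Rational.Unnormalised.Properties as UP
open import Algebra.Bundles using (CommutativeRing)
open import Algebra.Properties.Semiring.Sum (CommutativeRing.semiring QP.+-*-commutativeRing)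
  using (sum; sum-cong-≗; ∑-distrib-+; ∑-comm; *-distribˡ-sum)
open import Algebra.Properties.Group QP.+-0-group using (x∙y⁻¹≈ε⇒x≈y)
open import Level using (0ℓ)
open import Data.Maybe using (Maybe; just; nothing)
open import Data.Product using (∃; ∃-syntax; _×_; _,_; proj₁; proj₂)
open import Data.Sum using (_⊎_; inj₁; inj₂; swap)
open import Data.Empty using (⊥; ⊥-elim)
open import Relation.Nullary using (yes; no; does)
open import Relation.Nullary.Decidable using (⌊_⌋)
open import Relation.Binary.PropositionalEquality
open import Tactic.RingSolver using (solve-∀)
open import Tactic.RingSolver.Core.AlmostCommutativeRing using (AlmostCommutativeRing; fromCommutativeRing)

open import Defs

ℚ-ring : AlmostCommutativeRing 0ℓ 0ℓ
ℚ-ring = fromCommutativeRing QP.+-*-commutativeRing isZero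
  where
  isZero : ∀ x → Maybe (0ℚ ≡ x)
  isZero x with 0ℚ QP.≟ x
  ... | yes e = just e
  ... | no _  = nothing

fromℤ-+ : ∀ a b → fromℤ (a ℤ.+ b) ≡ fromℤ a + fromℤ b
fromℤ-+ a b = QP.toℚᵘ-injective (UP.≃-trans (U.*≡* eq) (UP.≃-sym (QP.toℚᵘ-homo-+ (fromℤ a) (fromℤ b))))
  where
  eq : (a ℤ.+ b) ℤ.* ℤ.+ 1 ≡ (a ℤ.* ℤ.+ 1 ℤ.+ b ℤ.* ℤ.+ 1) ℤ.* ℤ.+ 1
  eq = cong (ℤ._* ℤ.+ 1) (sym (cong₂ ℤ._+_ (ℤP.*-identityʳ a) (ℤP.*-identityʳ b)))

fromℤ-* : ∀ a b → fromℤ (a ℤ.* b) ≡ fromℤ a * fromℤ b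
fromℤ-* a b = QP.toℚᵘ-injective (UP.≃-trans (U.*≡* refl) (UP.≃-sym (QP.toℚᵘ-homo-* (fromℤ a) (fromℤ b))))

fromℤ-neg : ∀ a → fromℤ (ℤ.- a) ≡ - fromℤ a
fromℤ-neg a = QP.toℚᵘ-injective (UP.≃-trans (U.*≡* refl) (UP.≃-sym (QP.toℚᵘ-homo‿- (fromℤ a))))

fromℤ-- : ∀ a b → fromℤ (a ℤ.- b) ≡ fromℤ a - fromℤ b
fromℤ-- a b = trans (fromℤ-+ a (ℤ.- b)) (cong (λ z → fromℤ a + z) (fromℤ-neg b))

fromℤ-< : ∀ {a b} → a ℤ.< b → fromℤ a < fromℤ b
fromℤ-< {a} {b} a<b = Q.*<* (subst₂ ℤ._<_ (sym (ℤP.*-identityʳ a)) (sym (ℤP.*-identityʳ b)) a<b)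

↑ : ℕ → ℚ
↑ n = fromℤ (ℤ.+ n)

↑-+ : ∀ m n → ↑ (m ℕ.+ n) ≡ ↑ m + ↑ n
↑-+ m n = fromℤ-+ (ℤ.+ m) (ℤ.+ n)

↑-* : ∀ m n → ↑ (m ℕ.* n) ≡ ↑ m * ↑ n
↑-* m n = trans (cong fromℤ (ℤP.pos-* m n)) (fromℤ-* (ℤ.+ m) (ℤ.+ n))

↑-suc : ∀ n → ↑ (suc n) ≡ ↑ n + 1ℚ
↑-suc n = trans (cong ↑ (ℕP.+-comm 1 n)) (↑-+ n 1)

↑-∸ : ∀ {m n} → m ℕ.≤ n → ↑ (n ℕ.∸ m) ≡ ↑ n - ↑ m
↑-∸ {m} {n} m≤n = trans (lemma (↑ (n ℕ.∸ m)) (↑ m))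
  (cong (_- ↑ m) (trans (sym (↑-+ (n ℕ.∸ m) m)) (cong ↑ (ℕP.m∸n+n≡m m≤n))))
  where
  lemma : ∀ a b → a ≡ (a + b) - b
  lemma = solve-∀ ℚ-ring

↑-injective : ∀ {m n} → ↑ m ≡ ↑ n → m ≡ n
↑-injective eq = ℤP.+-injective (cong Q.↥_ eq)

↑-mono-≤ : ∀ {m n} → m ℕ.≤ n → ↑ m ≤ ↑ n
↑-mono-≤ {m} {n} m≤n = Q.*≤* (subst₂ ℤ._≤_ (sym (ℤP.*-identityʳ (ℤ.+ m))) (sym (ℤP.*-identityʳ (ℤ.+ n))) (ℤ.+≤+ m≤n))

↑-mono-< : ∀ {m n} → m ℕ.< n → ↑ m < ↑ n
↑-mono-< m<n = fromℤ-< (ℤ.+<+ m<n)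

↑-cancel-< : ∀ {m n} → ↑ m < ↑ n → m ℕ.< n
↑-cancel-< {m} {n} (Q.*<* m<n) = ℤP.drop‿+<+ (subst₂ ℤ._<_ (ℤP.*-identityʳ (ℤ.+ m)) (ℤP.*-identityʳ (ℤ.+ n)) m<n)

↑-double : ∀ n → ↑ (2 ℕ.* n) ≡ (1ℚ + 1ℚ) * ↑ n
↑-double n = trans (↑-* 2 n) (cong (_* ↑ n) (↑-+ 1 1))

x-y≡0⇒x≡y : ∀ x y → x - y ≡ 0ℚ → x ≡ y
x-y≡0⇒x≡y = x∙y⁻¹≈ε⇒x≈y

*-cancelˡ-≢0 : ∀ a {x y} → a ≢ 0ℚ → a * x ≡ a * y → x ≡ y
*-cancelˡ-≢0 a {x} {y} a≢0 eq = begin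
  x                ≡⟨ sym (QP.*-identityˡ x) ⟩
  1ℚ * x           ≡⟨ cong (_* x) (sym a⁻¹*a) ⟩
  (a⁻¹ * a) * x    ≡⟨ QP.*-assoc a⁻¹ a x ⟩
  a⁻¹ * (a * x)    ≡⟨ cong (a⁻¹ *_) eq ⟩
  a⁻¹ * (a * y)    ≡⟨ sym (QP.*-assoc a⁻¹ a y) ⟩
  (a⁻¹ * a) * y    ≡⟨ cong (_* y) a⁻¹*a ⟩
  1ℚ * y           ≡⟨ QP.*-identityˡ y ⟩
  y                ∎
  where
  open ≡-Reasoning
  a⁻¹ : ℚ
  a⁻¹ = (1/ a) {{Q.≢-nonZero a≢0}}
  a⁻¹*a : a⁻¹ * a ≡ 1ℚ
  a⁻¹*a = QP.*-inverseˡ a {{Q.≢-nonZero a≢0}}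

square-nonneg : ∀ x → 0ℚ ≤ x * x
square-nonneg x with QP.≤-total 0ℚ x
... | inj₁ 0≤x = QP.nonNegative⁻¹ _ {{QP.nonNeg*nonNeg⇒nonNeg x {{Q.nonNegative 0≤x}} x {{Q.nonNegative 0≤x}}}}
... | inj₂ x≤0 = QP.nonNegative⁻¹ _ {{QP.nonPos*nonPos⇒nonPos x {{Q.nonPositive x≤0}} x {{Q.nonPositive x≤0}}}}

square-zero : ∀ x → x * x ≡ 0ℚ → x ≡ 0ℚ
square-zero x xx≡0 with x QP.≟ 0ℚ
... | yes x≡0 = x≡0
... | no x≢0  = *-cancelˡ-≢0 x x≢0 (trans xx≡0 (sym (QP.*-zeroʳ x)))

sum-*ˡ : ∀ {n} c (f : Fin n → ℚ) → sum (λ i → c * f i) ≡ c * sum f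
sum-*ˡ c f = sym (*-distribˡ-sum c f)

sum-neg : ∀ {n} (f : Fin n → ℚ) → sum (λ i → - f i) ≡ - sum f
sum-neg {zero} f = refl
sum-neg {suc n} f = trans (cong (λ s → - f zero + s) (sum-neg (λ i → f (suc i))))
  (sym (QP.neg-distrib-+ (f zero) _))

sum-- : ∀ {n} (f g : Fin n → ℚ) → sum (λ i → f i - g i) ≡ sum f - sum g
sum-- f g = trans (∑-distrib-+ f (λ i → - g i)) (cong (λ s → sum f + s) (sum-neg g))

sum-const : ∀ {n} c → sum {n} (λ _ → c) ≡ ↑ n * c
sum-const {zero} c = sym (QP.*-zeroˡ c)
sum-const {suc n} c = trans (cong (λ z → c + z) (sum-const {n} c))
  (trans (lemma c (↑ n)) (cong (_* c) (sym (↑-+ 1 n))))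
  where
  lemma : ∀ c m → c + m * c ≡ (1ℚ + m) * c
  lemma = solve-∀ ℚ-ring

sum-interchange : ∀ {m n} (a : Fin m → ℚ) (h : Fin m → Fin n → ℚ) →
  sum (λ p → a p * sum (h p)) ≡ sum (λ l → sum (λ p → a p * h p l))
sum-interchange a h = trans (sum-cong-≗ (λ p → sym (sum-*ˡ (a p) (h p)))) (∑-comm (λ p l → a p * h p l))

δ : ∀ {n} → Fin n → Fin n → ℚ
δ zero    zero    = 1ℚ
δ zero    (suc _) = 0ℚ
δ (suc _) zero    = 0ℚ
δ (suc i) (suc j) = δ i j

δ-refl : ∀ {n} (i : Fin n) → δ i i ≡ 1ℚ
δ-refl zero    = refl
δ-refl (suc i) = δ-refl i

δ-≢ : ∀ {n} {i j : Fin n} → i ≢ j → δ i j ≡ 0ℚ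
δ-≢ {i = zero}  {zero}  i≢j = ⊥-elim (i≢j refl)
δ-≢ {i = zero}  {suc j} i≢j = refl
δ-≢ {i = suc i} {zero}  i≢j = refl
δ-≢ {i = suc i} {suc j} i≢j = δ-≢ (λ eq → i≢j (cong suc eq))

δ-sym : ∀ {n} (i j : Fin n) → δ i j ≡ δ j i
δ-sym zero    zero    = refl
δ-sym zero    (suc j) = refl
δ-sym (suc i) zero    = refl
δ-sym (suc i) (suc j) = δ-sym i j

sum-δ : ∀ {n} (i : Fin n) (f : Fin n → ℚ) → sum (λ j → δ i j * f j) ≡ f i
sum-δ {suc n} zero f = trans (cong (λ s → 1ℚ * f zero + s) (trans (sum-cong-≗ (λ j → QP.*-zeroˡ (f (suc j)))) (sum-const {n} 0ℚ)))
  (lemma (f zero) (↑ n))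
  where
  lemma : ∀ a m → 1ℚ * a + m * 0ℚ ≡ a
  lemma = solve-∀ ℚ-ring
sum-δ {suc n} (suc i) f = trans (cong (λ s → 0ℚ * f zero + s) (sum-δ i (λ j → f (suc j)))) (lemma (f zero) (f (suc i)))
  where
  lemma : ∀ a b → 0ℚ * a + b ≡ b
  lemma = solve-∀ ℚ-ring

sum-δ-row : ∀ {n} (i : Fin n) → sum (δ i) ≡ 1ℚ
sum-δ-row i = trans (sum-cong-≗ (λ j → sym (QP.*-identityʳ (δ i j)))) (sum-δ i (λ _ → 1ℚ))

sum-δʳ : ∀ {n} (i : Fin n) (f : Fin n → ℚ) → sum (λ j → f j * δ j i) ≡ f i
sum-δʳ i f = trans (sum-cong-≗ (λ j → trans (QP.*-comm (f j) (δ j i)) (cong (_* f j) (δ-sym j i)))) (sum-δ i f)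

sum-nonneg : ∀ {n} (f : Fin n → ℚ) → (∀ i → 0ℚ ≤ f i) → 0ℚ ≤ sum f
sum-nonneg {zero}  f f≥0 = QP.≤-refl
sum-nonneg {suc n} f f≥0 = QP.+-mono-≤ (f≥0 zero) (sum-nonneg (λ i → f (suc i)) (λ i → f≥0 (suc i)))

sum-mono-≤ : ∀ {n} (f g : Fin n → ℚ) → (∀ i → f i ≤ g i) → sum f ≤ sum g
sum-mono-≤ {zero}  f g f≤g = QP.≤-refl
sum-mono-≤ {suc n} f g f≤g = QP.+-mono-≤ (f≤g zero) (sum-mono-≤ (λ i → f (suc i)) (λ i → g (suc i)) (λ i → f≤g (suc i)))

summand≤sum : ∀ {n} (f : Fin n → ℚ) → (∀ i → 0ℚ ≤ f i) → ∀ a → f a ≤ sum f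
summand≤sum {suc n} f f≥0 zero = subst (_≤ sum f) (QP.+-identityʳ (f zero))
  (QP.+-monoʳ-≤ (f zero) (sum-nonneg (λ i → f (suc i)) (λ i → f≥0 (suc i))))
summand≤sum {suc n} f f≥0 (suc a) = QP.≤-trans (summand≤sum (λ i → f (suc i)) (λ i → f≥0 (suc i)) a)
  (subst (_≤ sum f) (QP.+-identityˡ _) (QP.+-monoˡ-≤ (sum (λ i → f (suc i))) (f≥0 zero)))

sum≡0⇒summand≡0 : ∀ {n} (f : Fin n → ℚ) → (∀ i → 0ℚ ≤ f i) → sum f ≡ 0ℚ → ∀ i → f i ≡ 0ℚ
sum≡0⇒summand≡0 f f≥0 Σf≡0 i = QP.≤-antisym (subst (f i ≤_) Σf≡0 (summand≤sum f f≥0 i)) (f≥0 i)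

χ : Bool → ℚ
χ true  = 1ℚ
χ false = 0ℚ

χ-nonneg : ∀ b → 0ℚ ≤ χ b
χ-nonneg true  = QP.nonNegative⁻¹ 1ℚ
χ-nonneg false = QP.≤-refl

χ-idem : ∀ b → χ b * χ b ≡ χ b
χ-idem true  = refl
χ-idem false = refl

χ-∧ : ∀ a b → χ (a ∧ b) ≡ χ a * χ b
χ-∧ true  b = sym (QP.*-identityˡ (χ b))
χ-∧ false b = sym (QP.*-zeroˡ (χ b))

χ-not : ∀ b → χ (not b) ≡ 1ℚ - χ b
χ-not true  = refl
χ-not false = refl

χ-xor : ∀ a b → χ (a xor b) ≡ χ a + χ b - (1ℚ + 1ℚ) * (χ a * χ b)
χ-xor true  true  = refl
χ-xor true  false = refl
χ-xor false true  = refl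
χ-xor false false = refl

χ-∧-xor : ∀ a b → χ a * χ (a xor b) ≡ χ a - χ a * χ b
χ-∧-xor true  true  = refl
χ-∧-xor true  false = refl
χ-∧-xor false true  = refl
χ-∧-xor false false = refl

χ-xor-∧-xor : ∀ a b c → χ (a xor b) * χ (a xor c) ≡ χ a - χ a * χ b - χ a * χ c + χ b * χ c
χ-xor-∧-xor true  true  true  = refl
χ-xor-∧-xor true  true  false = refl
χ-xor-∧-xor true  false true  = refl
χ-xor-∧-xor true  false false = refl
χ-xor-∧-xor false true  true  = refl
χ-xor-∧-xor false true  false = refl
χ-xor-∧-xor false false true  = refl
χ-xor-∧-xor false false false = refl

card : ∀ {n} (X : Subset n) → ↑ ∣ X ∣ ≡ sum (λ p → χ (lookup X p))
card []           = refl
card (true ∷ X)   = trans (↑-+ 1 ∣ X ∣) (cong (λ z → 1ℚ + z) (card X))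
card (false ∷ X)  = trans (card X) (sym (QP.+-identityˡ _))

card-tabulate : ∀ {n} (g : Fin n → Bool) → ↑ ∣ tabulate g ∣ ≡ sum (λ p → χ (g p))
card-tabulate g = trans (card (tabulate g)) (sum-cong-≗ (λ p → cong χ (lookup∘tabulate g p)))

card-∩ : ∀ {n} (X Y : Subset n) → ↑ ∣ X ∩ Y ∣ ≡ sum (λ p → χ (lookup X p) * χ (lookup Y p))
card-∩ X Y = trans (card (X ∩ Y))
  (sum-cong-≗ (λ p → trans (cong χ (lookup-zipWith _∧_ p X Y)) (χ-∧ (lookup X p) (lookup Y p))))

lookup-△ : ∀ {n} (X Y : Subset n) p → lookup (X △ Y) p ≡ lookup X p xor lookup Y p
lookup-△ (true  ∷ X) (true  ∷ Y) zero = refl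
lookup-△ (true  ∷ X) (false ∷ Y) zero = refl
lookup-△ (false ∷ X) (true  ∷ Y) zero = refl
lookup-△ (false ∷ X) (false ∷ Y) zero = refl
lookup-△ (x ∷ X) (y ∷ Y) (suc p) = lookup-△ X Y p

△-involutive : ∀ {n} (X Y : Subset n) → X △ (X △ Y) ≡ Y
△-involutive [] [] = refl
△-involutive (true  ∷ X) (true  ∷ Y) = cong (true ∷_) (△-involutive X Y)
△-involutive (true  ∷ X) (false ∷ Y) = cong (false ∷_) (△-involutive X Y)
△-involutive (false ∷ X) (true  ∷ Y) = cong (true ∷_) (△-involutive X Y)
△-involutive (false ∷ X) (false ∷ Y) = cong (false ∷_) (△-involutive X Y)

member : ∀ {n} (X : Subset n) → 0 ℕ.< ∣ X ∣ → ∃ λ p → lookup X p ≡ true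
member (true  ∷ X) _ = zero , refl
member (false ∷ X) h with member X h
... | p , p∈X = suc p , p∈X

full-or-missing : ∀ {n} (X : Subset n) → (∃ λ q → lookup X q ≡ false) ⊎ (∀ q → lookup X q ≡ true)
full-or-missing [] = inj₂ (λ ())
full-or-missing (false ∷ X) = inj₁ (zero , refl)
full-or-missing (true  ∷ X) with full-or-missing X
... | inj₁ (q , q∉X) = inj₁ (suc q , q∉X)
... | inj₂ full      = inj₂ λ { zero → refl ; (suc q) → full q }

full-∩ : ∀ {n} (X Y : Subset n) → (∀ p → lookup X p ≡ true) → X ∩ Y ≡ Y
full-∩ []      []      _    = refl
full-∩ (x ∷ X) (y ∷ Y) full rewrite full zero = cong (y ∷_) (full-∩ X Y (λ p → full (suc p)))

-- Let N be a square (n × n) matrix with idempotent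
-- entries (N i p ∈ {0,1}: block i contains point p) whose rows satisfy
--   Σ_p N i p · N j p = lam + δ i j · d i        (lam ≥ 0, all d i > 0),
-- i.e. N Nᵀ = lam J + D.
-- Then M = I + θ y yᵀ, the column form of (N Nᵀ)⁻¹ = D⁻¹ − θ D⁻¹ J D⁻¹.
-- Instead of inverting N we show that the defect P = M − (I + θ y yᵀ) is a
-- symmetric matrix with P² = −P and trace 0, so Σ P² = 0 and P = 0.  From
-- this every column sum r p of N (a replication number) is an affine
-- function of y p, which separates points inside and outside a block of
-- exceptional size.
module GramDual {n : ℕ} (N : Fin n → Fin n → ℚ) (N-idem : ∀ i p → N i p * N i p ≡ N i p)
  (lam : ℚ) (lam≥0 : 0ℚ ≤ lam) (d : Fin n → ℚ) (d>0 : ∀ i → 0ℚ < d i)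
  (gram : ∀ i j → sum (λ p → N i p * N j p) ≡ lam + δ i j * d i) where

  open ≡-Reasoning

  w : Fin n → ℚ
  w i = (1/ d i) {{Q.>-nonZero (d>0 i)}}

  w*d : ∀ i → w i * d i ≡ 1ℚ
  w*d i = QP.*-inverseˡ (d i) {{Q.>-nonZero (d>0 i)}}

  s : ℚ
  s = sum w

  den : ℚ
  den = 1ℚ + lam * s

  den>0 : 0ℚ < den
  den>0 = QP.<-≤-trans (QP.positive⁻¹ 1ℚ) (subst (_≤ den) (QP.+-identityʳ 1ℚ) (QP.+-monoʳ-≤ 1ℚ lam*s≥0))
    where
    w≥0 : ∀ i → 0ℚ ≤ w i
    w≥0 i = QP.nonNegative⁻¹ (w i) {{QP.pos⇒nonNeg (w i) {{QP.1/pos⇒pos (d i) {{Q.positive (d>0 i)}}}}}}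
    lam*s≥0 : 0ℚ ≤ lam * s
    lam*s≥0 = QP.nonNegative⁻¹ (lam * s)
      {{QP.nonNeg*nonNeg⇒nonNeg lam {{Q.nonNegative lam≥0}} s {{Q.nonNegative (sum-nonneg w w≥0)}}}}

  den⁻¹ : ℚ
  den⁻¹ = (1/ den) {{Q.>-nonZero den>0}}

  θ : ℚ
  θ = lam * den⁻¹

  θ*den : θ * den ≡ lam
  θ*den = trans (QP.*-assoc lam den⁻¹ den)
    (trans (cong (lam *_) (QP.*-inverseˡ den {{Q.>-nonZero den>0}})) (QP.*-identityʳ lam))

  y : Fin n → ℚ
  y p = sum (λ i → w i * N i p)

  M : Fin n → Fin n → ℚ
  M p q = sum (λ i → (w i * N i q) * N i p)

  P : Fin n → Fin n → ℚ
  P p q = M p q - (δ p q + θ * (y p * y q))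

  r : Fin n → ℚ
  r p = sum (λ i → N i p)

  Y : ℚ
  Y = sum y

  through-blocks : ∀ (x g : Fin n → ℚ) →
    sum (λ q → x q * sum (λ i → g i * N i q)) ≡ sum (λ i → g i * sum (λ q → x q * N i q))
  through-blocks x g = trans (sum-interchange x (λ q i → g i * N i q))
    (sum-cong-≗ (λ i → trans (sum-cong-≗ (λ q → lemma (x q) (g i) (N i q))) (sum-*ˡ {n} (g i) _)))
    where
    lemma : ∀ a b c → a * (b * c) ≡ b * (a * c)
    lemma = solve-∀ ℚ-ring

  weighted-gram : ∀ (g : Fin n → ℚ) i →
    sum (λ l → g l * sum (λ p → N i p * N l p)) ≡ lam * sum g + g i * d i
  weighted-gram g i = begin
    sum (λ l → g l * sum (λ p → N i p * N l p))   ≡⟨ sum-cong-≗ (λ l → cong (g l *_) (gram i l)) ⟩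
    sum (λ l → g l * (lam + δ i l * d i))          ≡⟨ sum-cong-≗ (λ l → lemma (g l) lam (δ i l) (d i)) ⟩
    sum (λ l → lam * g l + δ i l * (g l * d i))    ≡⟨ ∑-distrib-+ {n} _ _ ⟩
    sum (λ l → lam * g l) + sum (λ l → δ i l * (g l * d i))
                                                   ≡⟨ cong₂ _+_ (sum-*ˡ {n} lam g) (sum-δ i (λ l → g l * d i)) ⟩
    lam * sum g + g i * d i                        ∎
    where
    lemma : ∀ g l δ c → g * (l + δ * c) ≡ l * g + δ * (g * c)
    lemma = solve-∀ ℚ-ring

  N-y : ∀ i → sum (λ p → N i p * y p) ≡ lam * s + 1ℚ
  N-y i = trans (through-blocks (N i) w) (trans (weighted-gram w i) (cong (λ z → lam * s + z) (w*d i)))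

  N-M : ∀ i q → sum (λ p → N i p * M p q) ≡ lam * y q + N i q
  N-M i q = trans (through-blocks (N i) (λ l → w l * N l q))
    (trans (weighted-gram (λ l → w l * N l q) i) (cong (λ z → lam * y q + z) (lemma (w i) (N i q) (d i) (w*d i))))
    where
    lemma : ∀ w x d → w * d ≡ 1ℚ → (w * x) * d ≡ x
    lemma w x d wd≡1 = trans (lemma′ w x d) (trans (cong (_* x) wd≡1) (QP.*-identityˡ x))
      where
      lemma′ : ∀ w x d → (w * x) * d ≡ (w * d) * x
      lemma′ = solve-∀ ℚ-ring

  M-sym : ∀ p q → M p q ≡ M q p
  M-sym p q = sum-cong-≗ (λ i → lemma (w i) (N i q) (N i p))
    where
    lemma : ∀ w a b → (w * a) * b ≡ (w * b) * a
    lemma = solve-∀ ℚ-ring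

  P-sym : ∀ p q → P p q ≡ P q p
  P-sym p q = cong₂ _-_ (M-sym p q) (cong₂ _+_ (δ-sym p q) (cong (θ *_) (QP.*-comm (y p) (y q))))

  sum-against-P : ∀ (x : Fin n → ℚ) q →
    sum (λ p → x p * P p q) ≡ sum (λ p → x p * M p q) - (x q + θ * y q * sum (λ p → x p * y p))
  sum-against-P x q = begin
    sum (λ p → x p * P p q)
      ≡⟨ sum-cong-≗ (λ p → lemma (x p) (M p q) (δ p q) θ (y p) (y q)) ⟩
    sum (λ p → x p * M p q - (x p * δ p q + θ * y q * (x p * y p)))
      ≡⟨ trans (sum-- {n} _ _) (cong (λ z → sum (λ p → x p * M p q) - z) (∑-distrib-+ {n} _ _)) ⟩
    sum (λ p → x p * M p q) - (sum (λ p → x p * δ p q) + sum (λ p → θ * y q * (x p * y p)))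
      ≡⟨ cong (λ z → sum (λ p → x p * M p q) - z) (cong₂ _+_ (sum-δʳ q x) (sum-*ˡ {n} (θ * y q) _)) ⟩
    sum (λ p → x p * M p q) - (x q + θ * y q * sum (λ p → x p * y p)) ∎
    where
    lemma : ∀ x m δ t yp yq → x * (m - (δ + t * (yp * yq))) ≡ x * m - (x * δ + t * yq * (x * yp))
    lemma = solve-∀ ℚ-ring

  N-P : ∀ i q → sum (λ p → N i p * P p q) ≡ 0ℚ
  N-P i q = begin
    sum (λ p → N i p * P p q)                          ≡⟨ sum-against-P (N i) q ⟩
    sum (λ p → N i p * M p q) - (N i q + θ * y q * sum (λ p → N i p * y p))
                                                        ≡⟨ cong₂ (λ a b → a - (N i q + θ * y q * b)) (N-M i q) (N-y i) ⟩
    (lam * y q + N i q) - (N i q + θ * y q * (lam * s + 1ℚ))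
                                                        ≡⟨ lemma lam (y q) (N i q) θ s ⟩
    (lam - θ * den) * y q                               ≡⟨ cong (λ z → (lam - z) * y q) θ*den ⟩
    (lam - lam) * y q                                   ≡⟨ lemma′ lam (y q) ⟩
    0ℚ                                                  ∎
    where
    lemma : ∀ l yq x t s → (l * yq + x) - (x + t * yq * (l * s + 1ℚ)) ≡ (l - t * (1ℚ + l * s)) * yq
    lemma = solve-∀ ℚ-ring
    lemma′ : ∀ l a → (l - l) * a ≡ 0ℚ
    lemma′ = solve-∀ ℚ-ring

  P-N : ∀ p i → sum (λ q → P p q * N i q) ≡ 0ℚ
  P-N p i = trans (sum-cong-≗ (λ q → trans (QP.*-comm (P p q) (N i q)) (cong (N i q *_) (P-sym p q)))) (N-P i p)

  P-through-blocks : ∀ p (g : Fin n → ℚ) → sum (λ q → P p q * sum (λ i → g i * N i q)) ≡ 0ℚ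
  P-through-blocks p g = trans (through-blocks (P p) g)
    (trans (sum-cong-≗ (λ i → trans (cong (g i *_) (P-N p i)) (QP.*-zeroʳ (g i)))) (trans (sum-const {n} 0ℚ) (QP.*-zeroʳ (↑ n))))

  P² : ∀ p q → sum (λ l → P p l * P l q) ≡ - P p q
  P² p q = begin
    sum (λ l → P p l * P l q)                          ≡⟨ sum-against-P (P p) q ⟩
    sum (λ l → P p l * M l q) - (P p q + θ * y q * sum (λ l → P p l * y l))
                                                        ≡⟨ cong₂ (λ a b → a - (P p q + θ * y q * b))
                                                             (P-through-blocks p (λ i → w i * N i q)) (P-through-blocks p w) ⟩
    0ℚ - (P p q + θ * y q * 0ℚ)                        ≡⟨ lemma (P p q) (θ * y q) ⟩
    - P p q                                            ∎
    where
    lemma : ∀ a b → 0ℚ - (a + b * 0ℚ) ≡ - a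
    lemma = solve-∀ ℚ-ring

  row-square : ∀ i → sum (λ p → N i p * N i p) ≡ lam + d i
  row-square i = trans (gram i i) (trans (cong (λ z → lam + z * d i) (δ-refl i)) (cong (λ z → lam + z) (QP.*-identityˡ (d i))))

  trace-M : sum (λ p → M p p) ≡ lam * s + ↑ n
  trace-M = begin
    sum (λ p → M p p)                                  ≡⟨ ∑-comm (λ p i → (w i * N i p) * N i p) ⟩
    sum (λ i → sum (λ p → (w i * N i p) * N i p))      ≡⟨ sum-cong-≗ (λ i → trans (sum-cong-≗ (λ p → QP.*-assoc (w i) (N i p) (N i p))) (sum-*ˡ {n} (w i) _)) ⟩
    sum (λ i → w i * sum (λ p → N i p * N i p))        ≡⟨ sum-cong-≗ (λ i → trans (cong (w i *_) (row-square i)) (lemma (w i) lam (d i) (w*d i))) ⟩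
    sum (λ i → lam * w i + 1ℚ)                         ≡⟨ ∑-distrib-+ {n} _ _ ⟩
    sum (λ i → lam * w i) + sum {n} (λ _ → 1ℚ)         ≡⟨ cong₂ _+_ (sum-*ˡ {n} lam w) (trans (sum-const {n} 1ℚ) (QP.*-identityʳ (↑ n))) ⟩
    lam * s + ↑ n                                      ∎
    where
    lemma : ∀ w l d → w * d ≡ 1ℚ → w * (l + d) ≡ l * w + 1ℚ
    lemma w l d wd≡1 = trans (lemma′ w l d) (cong (λ z → l * w + z) wd≡1)
      where
      lemma′ : ∀ w l d → w * (l + d) ≡ l * w + w * d
      lemma′ = solve-∀ ℚ-ring

  sum-y² : sum (λ p → y p * y p) ≡ s * (lam * s + 1ℚ)
  sum-y² = begin
    sum (λ p → y p * y p)                              ≡⟨ through-blocks y w ⟩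
    sum (λ i → w i * sum (λ p → y p * N i p))          ≡⟨ sum-cong-≗ (λ i → cong (w i *_) (trans (sum-cong-≗ (λ p → QP.*-comm (y p) (N i p))) (N-y i))) ⟩
    sum (λ i → w i * (lam * s + 1ℚ))                   ≡⟨ sum-cong-≗ (λ i → QP.*-comm (w i) _) ⟩
    sum (λ i → (lam * s + 1ℚ) * w i)                   ≡⟨ sum-*ˡ {n} (lam * s + 1ℚ) w ⟩
    (lam * s + 1ℚ) * s                                 ≡⟨ QP.*-comm _ s ⟩
    s * (lam * s + 1ℚ)                                 ∎

  trace-P : sum (λ p → P p p) ≡ 0ℚ
  trace-P = begin
    sum (λ p → P p p)
      ≡⟨ trans (sum-- {n} _ _) (cong (λ z → sum (λ p → M p p) - z) (∑-distrib-+ {n} _ _)) ⟩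
    sum (λ p → M p p) - (sum {n} (λ p → δ p p) + sum (λ p → θ * (y p * y p)))
      ≡⟨ cong₂ (λ a b → a - b) trace-M (cong₂ _+_ trace-δ (sum-*ˡ {n} θ _)) ⟩
    (lam * s + ↑ n) - (↑ n + θ * sum (λ p → y p * y p))
      ≡⟨ cong (λ z → (lam * s + ↑ n) - (↑ n + θ * z)) sum-y² ⟩
    (lam * s + ↑ n) - (↑ n + θ * (s * (lam * s + 1ℚ)))
      ≡⟨ lemma lam s (↑ n) θ ⟩
    (lam - θ * den) * s
      ≡⟨ cong (λ z → (lam - z) * s) θ*den ⟩
    (lam - lam) * s
      ≡⟨ lemma′ lam s ⟩
    0ℚ ∎
    where
    trace-δ : sum {n} (λ p → δ p p) ≡ ↑ n
    trace-δ = trans (sum-cong-≗ {n} {x = λ p → δ p p} {y = λ _ → 1ℚ} δ-refl) (trans (sum-const {n} 1ℚ) (QP.*-identityʳ (↑ n)))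
    lemma : ∀ l s n t → (l * s + n) - (n + t * (s * (l * s + 1ℚ))) ≡ (l - t * (1ℚ + l * s)) * s
    lemma = solve-∀ ℚ-ring
    lemma′ : ∀ l a → (l - l) * a ≡ 0ℚ
    lemma′ = solve-∀ ℚ-ring

  -- Σ_{p,q} P p q² = Σ_p (P²) p p = − trace P = 0, so every entry of P vanishes.
  P≡0 : ∀ p q → P p q ≡ 0ℚ
  P≡0 p q = square-zero (P p q)
    (sum≡0⇒summand≡0 (λ q → P p q * P p q) (λ q → square-nonneg (P p q))
      (sum≡0⇒summand≡0 (λ p → sum (λ q → P p q * P p q)) (λ p → sum-nonneg _ (λ q → square-nonneg (P p q)))
        sum-squares p) q)
    where
    sum-squares : sum (λ p → sum (λ q → P p q * P p q)) ≡ 0ℚ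
    sum-squares = begin
      sum (λ p → sum (λ q → P p q * P p q))  ≡⟨ sum-cong-≗ (λ p → sum-cong-≗ (λ q → cong (P p q *_) (P-sym p q))) ⟩
      sum (λ p → sum (λ q → P p q * P q p))  ≡⟨ sum-cong-≗ (λ p → P² p p) ⟩
      sum (λ p → - P p p)                    ≡⟨ sum-neg {n} _ ⟩
      - sum (λ p → P p p)                    ≡⟨ cong -_ trace-P ⟩
      0ℚ                                     ∎

  M-formula : ∀ p q → M p q ≡ δ p q + θ * (y p * y q)
  M-formula p q = x-y≡0⇒x≡y _ _ (P≡0 p q)

  row-sum : ∀ i → sum (λ q → N i q) ≡ lam + d i
  row-sum i = trans (sum-cong-≗ (λ q → sym (N-idem i q))) (row-square i)

  M-row-sum : ∀ p → sum (λ q → M p q) ≡ lam * y p + r p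
  M-row-sum p = begin
    sum (λ q → M p q)                                  ≡⟨ sum-cong-≗ (M-sym p) ⟩
    sum (λ q → sum (λ i → (w i * N i p) * N i q))      ≡⟨ ∑-comm (λ q i → (w i * N i p) * N i q) ⟩
    sum (λ i → sum (λ q → (w i * N i p) * N i q))      ≡⟨ sum-cong-≗ (λ i → trans (sum-*ˡ (w i * N i p) (N i)) (cong ((w i * N i p) *_) (row-sum i))) ⟩
    sum (λ i → (w i * N i p) * (lam + d i))            ≡⟨ sum-cong-≗ (λ i → trans (expand (w i) (N i p) lam (d i)) (cong (λ z → lam * (w i * N i p) + N i p * z) (w*d i))) ⟩
    sum (λ i → lam * (w i * N i p) + N i p * 1ℚ)       ≡⟨ ∑-distrib-+ {n} _ _ ⟩
    sum (λ i → lam * (w i * N i p)) + sum (λ i → N i p * 1ℚ)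
                                                       ≡⟨ cong₂ _+_ (sum-*ˡ {n} lam _) (sum-cong-≗ (λ i → QP.*-identityʳ (N i p))) ⟩
    lam * y p + r p                                    ∎
    where
    expand : ∀ w x l d → (w * x) * (l + d) ≡ l * (w * x) + x * (w * d)
    expand = solve-∀ ℚ-ring

  -- Comparing the row sums of M with those of I + θ y yᵀ.
  replication-formula : ∀ p → r p ≡ 1ℚ + y p * (θ * Y - lam)
  replication-formula p = begin
    r p                                     ≡⟨ lemma (r p) lam (y p) ⟩
    (lam * y p + r p) - lam * y p           ≡⟨ cong (_- lam * y p) (trans (sym (M-row-sum p)) (sum-cong-≗ (M-formula p))) ⟩
    sum (λ q → δ p q + θ * (y p * y q)) - lam * y p
                                            ≡⟨ cong (_- lam * y p) (trans (∑-distrib-+ {n} _ _) (cong₂ _+_ (sum-δ-row p) (sum-*ˡ {n} θ _))) ⟩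
    (1ℚ + θ * sum (λ q → y p * y q)) - lam * y p
                                            ≡⟨ cong (λ z → (1ℚ + θ * z) - lam * y p) (sum-*ˡ (y p) y) ⟩
    (1ℚ + θ * (y p * Y)) - lam * y p        ≡⟨ lemma′ θ (y p) Y lam ⟩
    1ℚ + y p * (θ * Y - lam)                ∎
    where
    lemma : ∀ r l y → r ≡ (l * y + r) - l * y
    lemma = solve-∀ ℚ-ring
    lemma′ : ∀ t y Y l → (1ℚ + t * (y * Y)) - l * y ≡ 1ℚ + y * (t * Y - l)
    lemma′ = solve-∀ ℚ-ring

  total-replication : sum r ≡ sum (λ i → lam + d i)
  total-replication = trans (∑-comm (λ p i → N i p)) (sum-cong-≗ row-sum)

  constant-replication : θ * Y - lam ≡ 0ℚ → ∀ p → r p ≡ 1ℚ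
  constant-replication c≡0 p = trans (replication-formula p)
    (trans (cong (λ z → 1ℚ + y p * z) c≡0) (lemma (y p)))
    where
    lemma : ∀ a → 1ℚ + a * 0ℚ ≡ 1ℚ
    lemma = solve-∀ ℚ-ring

  lam≡0⇒constant-replication : lam ≡ 0ℚ → ∀ p → r p ≡ 1ℚ
  lam≡0⇒constant-replication lam≡0 = constant-replication (begin
    lam * den⁻¹ * Y - lam                ≡⟨ cong (λ l → l * den⁻¹ * Y - l) lam≡0 ⟩
    0ℚ * den⁻¹ * Y - 0ℚ                  ≡⟨ lemma den⁻¹ Y ⟩
    0ℚ                                   ∎)
    where
    lemma : ∀ a b → 0ℚ * a * b - 0ℚ ≡ 0ℚ
    lemma = solve-∀ ℚ-ring

  -- With lam > 0 and integral excesses d i ≥ 1 the replication numbers sum to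
  -- more than n, so they are not all 1.
  replication-not-constant : 0ℚ < lam → (∀ i → 1ℚ ≤ d i) → Fin n → θ * Y - lam ≢ 0ℚ
  replication-not-constant lam>0 d≥1 p c≡0 = QP.<-irrefl refl (QP.<-≤-trans n<n*lam+n n*lam+n≤n)
    where
    n>0 : 0ℚ < ↑ n
    n>0 = ↑-mono-< (ℕ.>-nonZero⁻¹ n {{nonZeroIndex p}})
    n<n*lam+n : ↑ n < ↑ n * lam + ↑ n
    n<n*lam+n = subst (_< ↑ n * lam + ↑ n) (QP.+-identityˡ (↑ n))
      (QP.+-monoˡ-< (↑ n) (QP.positive⁻¹ (↑ n * lam) {{QP.pos*pos⇒pos (↑ n) {{Q.positive n>0}} lam {{Q.positive lam>0}}}}))
    sum-n : sum {n} (λ _ → 1ℚ) ≡ ↑ n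
    sum-n = trans (sum-const {n} 1ℚ) (QP.*-identityʳ (↑ n))
    lower : sum {n} (λ _ → lam + 1ℚ) ≡ ↑ n * lam + ↑ n
    lower = trans (∑-distrib-+ {n} _ _) (cong₂ _+_ (sum-const {n} lam) sum-n)
    upper : sum (λ i → lam + d i) ≡ ↑ n
    upper = trans (sym total-replication) (trans (sum-cong-≗ (constant-replication c≡0)) sum-n)
    n*lam+n≤n : ↑ n * lam + ↑ n ≤ ↑ n
    n*lam+n≤n = subst₂ _≤_ lower upper (sum-mono-≤ _ _ (λ i → QP.+-monoʳ-≤ lam (d≥1 i)))

  w≡⇒d≡ : ∀ i j → w i ≡ w j → d i ≡ d j
  w≡⇒d≡ i j wi≡wj = begin
    d i                    ≡⟨ sym (QP.*-identityʳ (d i)) ⟩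
    d i * 1ℚ               ≡⟨ cong (d i *_) (sym (w*d j)) ⟩
    d i * (w j * d j)      ≡⟨ cong (λ z → d i * (z * d j)) (sym wi≡wj) ⟩
    d i * (w i * d j)      ≡⟨ lemma (d i) (w i) (d j) ⟩
    (w i * d i) * d j      ≡⟨ cong (_* d j) (w*d i) ⟩
    1ℚ * d j               ≡⟨ QP.*-identityˡ (d j) ⟩
    d j                    ∎
    where
    lemma : ∀ a b c → a * (b * c) ≡ (b * a) * c
    lemma = solve-∀ ℚ-ring

  d≡⇒w≡ : ∀ i j → d i ≡ d j → w i ≡ w j
  d≡⇒w≡ i j di≡dj = begin
    w i                    ≡⟨ sym (QP.*-identityʳ (w i)) ⟩
    w i * 1ℚ               ≡⟨ cong (w i *_) (sym (w*d j)) ⟩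
    w i * (w j * d j)      ≡⟨ cong (λ z → w i * (w j * z)) (sym di≡dj) ⟩
    w i * (w j * d i)      ≡⟨ lemma (w i) (w j) (d i) ⟩
    (w i * d i) * w j      ≡⟨ cong (_* w j) (w*d i) ⟩
    1ℚ * w j               ≡⟨ QP.*-identityˡ (w j) ⟩
    w j                    ∎
    where
    lemma : ∀ a b c → a * (b * c) ≡ (a * c) * b
    lemma = solve-∀ ℚ-ring

  -- Suppose every block other than a has the excess d b.  Then
  -- y = w b · r + (w a − w b) · N a, and together with the replication
  -- formula this shows that a point of block a and a point outside it
  -- cannot have the same replication number unless d a = d b.
  module ExceptionalBlock (a b : Fin n) (d-others : ∀ i → i ≢ a → d i ≡ d b) where

    y-split : ∀ x → y x ≡ w b * r x + (w a - w b) * N a x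
    y-split x = begin
      y x                                                       ≡⟨ sum-cong-≗ split ⟩
      sum (λ i → w b * N i x + δ a i * ((w a - w b) * N a x))   ≡⟨ ∑-distrib-+ {n} _ _ ⟩
      sum (λ i → w b * N i x) + sum (λ i → δ a i * ((w a - w b) * N a x))
                                                                ≡⟨ cong₂ _+_ (sum-*ˡ {n} (w b) _) (sum-δ a (λ _ → (w a - w b) * N a x)) ⟩
      w b * r x + (w a - w b) * N a x                           ∎
      where
      at-a : ∀ wa wb e → wa * e ≡ wb * e + 1ℚ * ((wa - wb) * e)
      at-a = solve-∀ ℚ-ring
      elsewhere : ∀ wb e f → wb * e ≡ wb * e + 0ℚ * f
      elsewhere = solve-∀ ℚ-ring
      split : ∀ i → w i * N i x ≡ w b * N i x + δ a i * ((w a - w b) * N a x)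
      split i with i ≟ a
      ... | yes refl = trans (at-a (w i) (w b) (N i x)) (cong (λ z → w b * N i x + z * ((w i - w b) * N i x)) (sym (δ-refl i)))
      ... | no i≢a   = trans (cong (_* N i x) (d≡⇒w≡ i b (d-others i i≢a)))
                         (trans (elsewhere (w b) (N i x) ((w a - w b) * N a x))
                           (cong (λ z → w b * N i x + z * ((w a - w b) * N a x)) (sym (δ-≢ (λ a≡i → i≢a (sym a≡i))))))

    separation : 0ℚ < lam → (∀ i → 1ℚ ≤ d i) → d a ≢ d b →
                 ∀ p q → N a p ≡ 1ℚ → N a q ≡ 0ℚ → r p ≢ r q
    separation lam>0 d≥1 da≢db p q p∈a q∉a rp≡rq with θ * Y - lam QP.≟ 0ℚ
    ... | yes c≡0 = replication-not-constant lam>0 d≥1 p c≡0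
    ... | no c≢0  = da≢db (w≡⇒d≡ a b wa≡wb)
      where
      c : ℚ
      c = θ * Y - lam
      yp≡yq : y p ≡ y q
      yp≡yq = *-cancelˡ-≢0 c c≢0 (begin
        c * y p           ≡⟨ lemma (y p) c ⟩
        (1ℚ + y p * c) - 1ℚ ≡⟨ cong (_- 1ℚ) (trans (sym (replication-formula p)) (trans rp≡rq (replication-formula q))) ⟩
        (1ℚ + y q * c) - 1ℚ ≡⟨ sym (lemma (y q) c) ⟩
        c * y q           ∎)
        where
        lemma : ∀ y c → c * y ≡ (1ℚ + y * c) - 1ℚ
        lemma = solve-∀ ℚ-ring
      wa≡wb : w a ≡ w b
      wa≡wb = begin
        w a                                                  ≡⟨ lemma (w a) (w b) (r p) ⟩
        (w b * r p + (w a - w b) * 1ℚ) - w b * r p + w b      ≡⟨ cong₂ (λ u v → (w b * r p + (w a - w b) * u) - w b * v + w b) (sym p∈a) rp≡rq ⟩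
        (w b * r p + (w a - w b) * N a p) - w b * r q + w b   ≡⟨ cong₂ (λ u v → u - v + w b) (sym (y-split p)) (lemma′ (w b * r q) (w a - w b) (N a q) q∉a) ⟩
        y p - (w b * r q + (w a - w b) * N a q) + w b         ≡⟨ cong (λ u → y p - u + w b) (trans (sym (y-split q)) (sym yp≡yq)) ⟩
        y p - y p + w b                                      ≡⟨ lemma″ (y p) (w b) ⟩
        w b                                                  ∎
        where
        lemma : ∀ wa wb r → wa ≡ (wb * r + (wa - wb) * 1ℚ) - wb * r + wb
        lemma = solve-∀ ℚ-ring
        lemma′ : ∀ a c e → e ≡ 0ℚ → a ≡ a + c * e
        lemma′ a c e e≡0 = trans (sym (QP.+-identityʳ a)) (cong (λ z → a + z) (trans (sym (QP.*-zeroʳ c)) (cong (c *_) (sym e≡0))))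
        lemma″ : ∀ a b → a - a + b ≡ b
        lemma″ = solve-∀ ℚ-ring

two-positives : ∀ {a b} → 1 ℕ.≤ a → 1 ℕ.≤ b → a ≢ b → 2 ℕ.≤ a ⊎ 2 ℕ.≤ b
two-positives {suc (suc _)} {_}           _ _ _   = inj₁ (s≤s (s≤s z≤n))
two-positives {1}           {suc (suc _)} _ _ _   = inj₂ (s≤s (s≤s z≤n))
two-positives {1}           {1}           _ _ a≢b = ⊥-elim (a≢b refl)

module RyserIncidence {v lam : ℕ} (B : Blocks v) (ry : IsRyser v lam B) where

  open IsRyser ry

  N : Fin v → Fin v → ℚ
  N i p = χ (lookup (B i) p)

  size : ∀ i → sum (N i) ≡ ↑ ∣ B i ∣
  size i = sym (card (B i))

  meetℚ : ∀ i j → i ≢ j → sum (λ p → N i p * N j p) ≡ ↑ lam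
  meetℚ i j i≢j = trans (sym (card-∩ (B i) (B j))) (cong ↑ (meet i j i≢j))

  d : Fin v → ℚ
  d i = ↑ ∣ B i ∣ - ↑ lam

  lam+d : ∀ i → ↑ lam + d i ≡ ↑ ∣ B i ∣
  lam+d i = lemma (↑ lam) (↑ ∣ B i ∣)
    where
    lemma : ∀ l k → l + (k - l) ≡ k
    lemma = solve-∀ ℚ-ring

  d≥1 : ∀ i → 1ℚ ≤ d i
  d≥1 i = subst₂ _≤_ (lemma (↑ lam)) refl
    (QP.+-monoˡ-≤ (- ↑ lam) (subst (_≤ ↑ ∣ B i ∣) (↑-suc lam) (↑-mono-≤ (bigBlocks i))))
    where
    lemma : ∀ l → l + 1ℚ - l ≡ 1ℚ
    lemma = solve-∀ ℚ-ring

  gram : ∀ i j → sum (λ p → N i p * N j p) ≡ ↑ lam + δ i j * d i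
  gram i j with i ≟ j
  ... | yes refl = trans (sum-cong-≗ (λ p → χ-idem (lookup (B i) p)))
                     (trans (size i) (trans (sym (lam+d i)) (cong (λ z → ↑ lam + z) d≡δ*d)))
    where
    d≡δ*d : d i ≡ δ i i * d i
    d≡δ*d = trans (sym (QP.*-identityˡ (d i))) (cong (_* d i) (sym (δ-refl i)))
  ... | no i≢j   = trans (meetℚ i j i≢j) (lemma (↑ lam) (d i) (δ i j) (δ-≢ i≢j))
    where
    lemma : ∀ l e δ → δ ≡ 0ℚ → l ≡ l + δ * e
    lemma l e δ δ≡0 = trans (sym (QP.+-identityʳ l)) (cong (λ z → l + z) (trans (sym (QP.*-zeroˡ e)) (cong (_* e) (sym δ≡0))))

  open GramDual N (λ i p → χ-idem (lookup (B i) p)) (↑ lam) (↑-mono-≤ z≤n) d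
    (λ i → QP.<-≤-trans (QP.positive⁻¹ 1ℚ) (d≥1 i)) gram public

  rep≡r : ∀ p → ↑ (rep B p) ≡ r p
  rep≡r p = card-tabulate (λ i → lookup (B i) p)

  -- The index of a Ryser design is positive: for lam = 0 every point would
  -- lie in exactly one block, forcing all blocks to be singletons.
  index-positive : 0 ℕ.< lam
  index-positive with lam ℕ.≟ 0
  ... | no lam≢0 = ℕP.n≢0⇒n>0 lam≢0
  ... | yes lam≡0 = ⊥-elim (QP.<-irrefl refl (QP.<-≤-trans (QP.positive⁻¹ 1ℚ) 1≤0))
    where
    excess : Fin v → ℚ
    excess i = ↑ ∣ B i ∣ - 1ℚ
    excess≥0 : ∀ i → 0ℚ ≤ excess i
    excess≥0 i = QP.≤-trans (QP.≤-reflexive (sym (QP.+-inverseʳ 1ℚ)))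
      (QP.+-monoˡ-≤ (- 1ℚ) (↑-mono-≤ (ℕP.≤-trans (s≤s z≤n) (bigBlocks i))))
    total-excess : sum excess ≡ 0ℚ
    total-excess = begin
      sum excess                                   ≡⟨ sum-cong-≗ (λ i → cong (_- 1ℚ) (sym (lam+d i))) ⟩
      sum (λ i → (↑ lam + d i) - 1ℚ)               ≡⟨ sum-- {v} _ _ ⟩
      sum (λ i → ↑ lam + d i) - sum {v} (λ _ → 1ℚ) ≡⟨ cong (_- sum {v} (λ _ → 1ℚ)) (sym total-replication) ⟩
      sum r - sum {v} (λ _ → 1ℚ)                   ≡⟨ cong (_- sum {v} (λ _ → 1ℚ)) (sum-cong-≗ (lam≡0⇒constant-replication (cong ↑ lam≡0))) ⟩
      sum {v} (λ _ → 1ℚ) - sum {v} (λ _ → 1ℚ)      ≡⟨ QP.+-inverseʳ (sum {v} (λ _ → 1ℚ)) ⟩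
      0ℚ                                           ∎
      where open ≡-Reasoning
    large-block : ∃ λ m → 2 ℕ.≤ ∣ B m ∣
    large-block with twoSizes
    ... | i , j , ki≢kj with two-positives (ℕP.≤-trans (s≤s z≤n) (bigBlocks i)) (ℕP.≤-trans (s≤s z≤n) (bigBlocks j)) ki≢kj
    ...   | inj₁ 2≤ki = i , 2≤ki
    ...   | inj₂ 2≤kj = j , 2≤kj
    m : Fin v
    m = proj₁ large-block
    1≤0 : 1ℚ ≤ 0ℚ
    1≤0 = QP.≤-trans (QP.+-monoˡ-≤ (- 1ℚ) (↑-mono-≤ (proj₂ large-block)))
            (QP.≤-trans (summand≤sum excess excess≥0 m) (QP.≤-reflexive total-excess))

separation : ∀ {v lam} {B : Blocks v} → IsRyser v lam B →
  ∀ a b → (∀ i → i ≢ a → ∣ B i ∣ ≡ ∣ B b ∣) → ∣ B a ∣ ≢ ∣ B b ∣ →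
  ∀ p q → lookup (B a) p ≡ true → lookup (B a) q ≡ false → rep B p ≢ rep B q
separation {v} {lam} {B} ry a b same differ p q p∈a q∉a rp≡rq =
  ExceptionalBlock.separation a b (λ i i≢a → cong (_- ↑ lam) (cong ↑ (same i i≢a)))
    (↑-mono-< index-positive) d≥1 (λ da≡db → differ (↑-injective (d-injective da≡db)))
    p q (cong χ p∈a) (cong χ q∉a) (trans (sym (rep≡r p)) (trans (cong ↑ rp≡rq) (rep≡r q)))
  where
  open RyserIncidence B ry
  d-injective : d a ≡ d b → ↑ ∣ B a ∣ ≡ ↑ ∣ B b ∣
  d-injective da≡db = trans (sym (lam+d a)) (trans (cong (λ z → ↑ lam + z) da≡db) (lam+d b))

-- The family derived from B at block a: keep B a and replace every other
-- block B i by B a △ B i.  This is the inverse of the Type-1 construction.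
derived : ∀ {v} → Blocks v → Fin v → Blocks v
derived B a i = if does (i ≟ a) then B a else B a △ B i

derived-self : ∀ {v} (B : Blocks v) a → derived B a a ≡ B a
derived-self B a with a ≟ a
... | yes _   = refl
... | no a≢a = ⊥-elim (a≢a refl)

derived-other : ∀ {v} (B : Blocks v) {a i} → i ≢ a → derived B a i ≡ B a △ B i
derived-other B {a} {i} i≢a with i ≟ a
... | yes i≡a = ⊥-elim (i≢a i≡a)
... | no _    = refl

module Differences {v lam : ℕ} (B : Blocks v) (ry : IsRyser v lam B) where

  open RyserIncidence B ry using (N; size; meetℚ)

  χ-△ : ∀ a i p → χ (lookup (B a △ B i) p) ≡ χ (lookup (B a) p xor lookup (B i) p)
  χ-△ a i p = cong χ (lookup-△ (B a) (B i) p)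

  card-△ : ∀ {a i} → a ≢ i → ↑ ∣ B a △ B i ∣ ≡ ↑ ∣ B a ∣ + ↑ ∣ B i ∣ - (1ℚ + 1ℚ) * ↑ lam
  card-△ {a} {i} a≢i = begin
    ↑ ∣ B a △ B i ∣                                              ≡⟨ card (B a △ B i) ⟩
    sum (λ p → χ (lookup (B a △ B i) p))                         ≡⟨ sum-cong-≗ (λ p → trans (χ-△ a i p) (χ-xor (lookup (B a) p) (lookup (B i) p))) ⟩
    sum (λ p → N a p + N i p - (1ℚ + 1ℚ) * (N a p * N i p))      ≡⟨ sum-- {v} _ _ ⟩
    sum (λ p → N a p + N i p) - sum (λ p → (1ℚ + 1ℚ) * (N a p * N i p))
                                                                 ≡⟨ cong₂ _-_ (∑-distrib-+ (N a) (N i)) (sum-*ˡ {v} (1ℚ + 1ℚ) _) ⟩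
    sum (N a) + sum (N i) - (1ℚ + 1ℚ) * sum (λ p → N a p * N i p)
                                                                 ≡⟨ cong₂ (λ x y → x - (1ℚ + 1ℚ) * y) (cong₂ _+_ (size a) (size i)) (meetℚ a i a≢i) ⟩
    ↑ ∣ B a ∣ + ↑ ∣ B i ∣ - (1ℚ + 1ℚ) * ↑ lam                    ∎
    where open ≡-Reasoning

  card-∩-△ : ∀ {a j} → a ≢ j → ↑ ∣ B a ∩ (B a △ B j) ∣ ≡ ↑ ∣ B a ∣ - ↑ lam
  card-∩-△ {a} {j} a≢j = begin
    ↑ ∣ B a ∩ (B a △ B j) ∣                           ≡⟨ card-∩ (B a) (B a △ B j) ⟩
    sum (λ p → N a p * χ (lookup (B a △ B j) p))      ≡⟨ sum-cong-≗ (λ p → trans (cong (N a p *_) (χ-△ a j p)) (χ-∧-xor (lookup (B a) p) (lookup (B j) p))) ⟩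
    sum (λ p → N a p - N a p * N j p)                 ≡⟨ sum-- {v} _ _ ⟩
    sum (N a) - sum (λ p → N a p * N j p)             ≡⟨ cong₂ _-_ (size a) (meetℚ a j a≢j) ⟩
    ↑ ∣ B a ∣ - ↑ lam                                 ∎
    where open ≡-Reasoning

  card-△-∩-△ : ∀ {a i j} → a ≢ i → a ≢ j → i ≢ j → ↑ ∣ (B a △ B i) ∩ (B a △ B j) ∣ ≡ ↑ ∣ B a ∣ - ↑ lam
  card-△-∩-△ {a} {i} {j} a≢i a≢j i≢j = begin
    ↑ ∣ (B a △ B i) ∩ (B a △ B j) ∣                   ≡⟨ card-∩ (B a △ B i) (B a △ B j) ⟩
    sum (λ p → χ (lookup (B a △ B i) p) * χ (lookup (B a △ B j) p))
                                                      ≡⟨ sum-cong-≗ (λ p → trans (cong₂ _*_ (χ-△ a i p) (χ-△ a j p))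
                                                                                (χ-xor-∧-xor (lookup (B a) p) (lookup (B i) p) (lookup (B j) p))) ⟩
    sum (λ p → N a p - N a p * N i p - N a p * N j p + N i p * N j p)
                                                      ≡⟨ trans (∑-distrib-+ {v} _ _) (cong (λ z → z + sum (λ p → N i p * N j p))
                                                           (trans (sum-- {v} _ _) (cong (λ z → z - sum (λ p → N a p * N j p)) (sum-- {v} _ _)))) ⟩
    sum (N a) - sum (λ p → N a p * N i p) - sum (λ p → N a p * N j p) + sum (λ p → N i p * N j p)
                                                      ≡⟨ cong₂ _+_ (cong₂ _-_ (cong₂ _-_ (size a) (meetℚ a i a≢i)) (meetℚ a j a≢j)) (meetℚ i j i≢j) ⟩
    (↑ ∣ B a ∣) - ↑ lam - ↑ lam + ↑ lam               ≡⟨ lemma (↑ ∣ B a ∣) (↑ lam) ⟩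
    (↑ ∣ B a ∣) - ↑ lam                               ∎
    where
    open ≡-Reasoning
    lemma : ∀ K l → K - l - l + l ≡ K - l
    lemma = solve-∀ ℚ-ring

module Derived {v lam : ℕ} (B : Blocks v) (ry : IsRyser v lam B)
  (a : Fin v) (k : ℕ) (others : ∀ i → i ≢ a → ∣ B i ∣ ≡ k) where

  open IsRyser ry
  open RyserIncidence B ry using (N; index-positive)
  open Differences B ry

  D : Blocks v
  D = derived B a

  K : ℕ
  K = ∣ B a ∣

  μ : ℕ
  μ = K ℕ.∸ lam

  ↑μ : ↑ μ ≡ ↑ K - ↑ lam
  ↑μ = ↑-∸ (ℕP.<⇒≤ (bigBlocks a))

  size-other : ∀ {i} → i ≢ a → ↑ ∣ B a △ B i ∣ ≡ ↑ K + ↑ k - (1ℚ + 1ℚ) * ↑ lam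
  size-other {i} i≢a = trans (card-△ (≢-sym i≢a)) (cong (λ x → ↑ K + ↑ x - (1ℚ + 1ℚ) * ↑ lam) (others i i≢a))

  derived-meet : ∀ i j → i ≢ j → ∣ D i ∩ D j ∣ ≡ μ
  derived-meet i j i≢j with i ≟ a | j ≟ a
  ... | yes refl | yes refl = ⊥-elim (i≢j refl)
  ... | yes refl | no j≢a   = ↑-injective (trans (card-∩-△ (≢-sym j≢a)) (sym ↑μ))
  ... | no i≢a   | yes refl = trans (cong ∣_∣ (∩-comm (B a △ B i) (B a))) (↑-injective (trans (card-∩-△ (≢-sym i≢a)) (sym ↑μ)))
  ... | no i≢a   | no j≢a   = ↑-injective (trans (card-△-∩-△ (≢-sym i≢a) (≢-sym j≢a) i≢j) (sym ↑μ))

  recover : ∀ i → i ≢ a → B i ≡ D a △ D i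
  recover i i≢a = sym (trans (cong₂ _△_ (derived-self B a) (derived-other B i≢a)) (△-involutive (B a) (B i)))

  derived-symmetric : k ≡ 2 ℕ.* lam → IsSymmetric v K μ D
  derived-symmetric k≡2lam = record
    { μ≥1  = ℕP.m<n⇒0<n∸m (bigBlocks a)
    ; μ<k  = ℕP.∸-monoʳ-< index-positive (ℕP.<⇒≤ (bigBlocks a))
    ; size = derived-size
    ; meet = derived-meet
    }
    where
    derived-size : ∀ i → ∣ D i ∣ ≡ K
    derived-size i with i ≟ a
    ... | yes refl = refl
    ... | no i≢a   = ↑-injective (trans (size-other i≢a)
                       (trans (cong (λ x → ↑ K + x - (1ℚ + 1ℚ) * ↑ lam) (trans (cong ↑ k≡2lam) (↑-double lam))) (lemma (↑ K) (↑ lam))))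
      where
      lemma : ∀ K l → K + (1ℚ + 1ℚ) * l - (1ℚ + 1ℚ) * l ≡ K
      lemma = solve-∀ ℚ-ring

  derived-ryser : ∀ b → b ≢ a → k ≢ 2 ℕ.* lam → IsRyser v μ D
  derived-ryser b b≢a k≢2lam = record
    { meet      = derived-meet
    ; bigBlocks = big
    ; twoSizes  = a , b , sizes-differ
    }
    where
    μ<K : μ ℕ.< K
    μ<K = ℕP.∸-monoʳ-< index-positive (ℕP.<⇒≤ (bigBlocks a))
    big : ∀ i → μ ℕ.< ∣ D i ∣
    big i with i ≟ a
    ... | yes refl = μ<K
    ... | no i≢a   = ↑-cancel-< (subst₂ _<_ (sym ↑μ) (sym (size-other i≢a))
                       (subst₂ _<_ (lemma (↑ K) (↑ lam)) (lemma′ (↑ K) (↑ k) (↑ lam))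
                         (QP.+-monoʳ-< (↑ K - (1ℚ + 1ℚ) * ↑ lam)
                           (↑-mono-< (subst (lam ℕ.<_) (others i i≢a) (bigBlocks i))))))
      where
      lemma : ∀ K l → K - (1ℚ + 1ℚ) * l + l ≡ K - l
      lemma = solve-∀ ℚ-ring
      lemma′ : ∀ K k l → K - (1ℚ + 1ℚ) * l + k ≡ K + k - (1ℚ + 1ℚ) * l
      lemma′ = solve-∀ ℚ-ring
    sizes-differ : ∣ D a ∣ ≢ ∣ D b ∣
    sizes-differ Da≡Db = k≢2lam (↑-injective (trans (lemma (↑ K) (↑ k) (↑ lam) (trans (cong ↑ K≡Dab) (size-other b≢a)))
                                               (sym (↑-double lam))))
      where
      K≡Dab : K ≡ ∣ B a △ B b ∣
      K≡Dab = trans (sym (cong ∣_∣ (derived-self B a))) (trans Da≡Db (cong ∣_∣ (derived-other B b≢a)))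
      lemma : ∀ K k l → K ≡ K + k - (1ℚ + 1ℚ) * l → k ≡ (1ℚ + 1ℚ) * l
      lemma K k l eq = trans (lemma₁ K k l) (trans (cong (λ z → z - K + (1ℚ + 1ℚ) * l) (sym eq)) (lemma₂ K l))
        where
        lemma₁ : ∀ K k l → k ≡ (K + k - (1ℚ + 1ℚ) * l) - K + (1ℚ + 1ℚ) * l
        lemma₁ = solve-∀ ℚ-ring
        lemma₂ : ∀ K l → K - K + (1ℚ + 1ℚ) * l ≡ (1ℚ + 1ℚ) * l
        lemma₂ = solve-∀ ℚ-ring

  rep-outside : ∀ q → lookup (B a) q ≡ false → rep D q ≡ rep B q
  rep-outside q q∉a = cong ∣_∣ (tabulate-cong same)
    where
    same : ∀ i → lookup (D i) q ≡ lookup (B i) q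
    same i with i ≟ a
    ... | yes refl = refl
    ... | no i≢a   = trans (lookup-△ (B a) (B i) q) (cong (_xor lookup (B i) q) q∉a)

  rep-inside : ∀ p → lookup (B a) p ≡ true → rep D p ℕ.+ rep B p ≡ suc v
  rep-inside p p∈a = ↑-injective (begin
    ↑ (rep D p ℕ.+ rep B p)                                  ≡⟨ ↑-+ (rep D p) (rep B p) ⟩
    ↑ (rep D p) + ↑ (rep B p)                                ≡⟨ cong₂ _+_ (card-tabulate (λ i → lookup (D i) p)) (card-tabulate (λ i → lookup (B i) p)) ⟩
    sum (λ i → χ (lookup (D i) p)) + sum (λ i → N i p)       ≡⟨ cong (λ z → z + sum (λ i → N i p)) (sum-cong-≗ inside) ⟩
    sum (λ i → 1ℚ - N i p + δ a i) + sum (λ i → N i p)       ≡⟨ cong (λ z → z + sum (λ i → N i p)) (trans (∑-distrib-+ {v} _ _) (cong₂ _+_ (sum-- {v} _ _) (sum-δ-row a))) ⟩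
    sum {v} (λ _ → 1ℚ) - sum (λ i → N i p) + 1ℚ + sum (λ i → N i p)
                                                             ≡⟨ cong (λ z → z - sum (λ i → N i p) + 1ℚ + sum (λ i → N i p)) (trans (sum-const {v} 1ℚ) (QP.*-identityʳ (↑ v))) ⟩
    ↑ v - sum (λ i → N i p) + 1ℚ + sum (λ i → N i p)         ≡⟨ lemma (↑ v) (sum (λ i → N i p)) ⟩
    ↑ v + 1ℚ                                                 ≡⟨ sym (↑-suc v) ⟩
    ↑ (suc v)                                                ∎)
    where
    open ≡-Reasoning
    inside : ∀ i → χ (lookup (D i) p) ≡ 1ℚ - N i p + δ a i
    inside i with i ≟ a
    ... | yes refl = trans (cong χ p∈a) (sym (trans (cong (λ x → 1ℚ - χ x + δ a a) p∈a) (cong (λ z → 1ℚ - 1ℚ + z) (δ-refl a))))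
    ... | no i≢a   = trans (χ-△ a i p)
                       (trans (cong (λ x → χ (x xor lookup (B i) p)) p∈a)
                         (trans (χ-not (lookup (B i) p))
                           (trans (sym (QP.+-identityʳ _)) (cong (λ z → 1ℚ - N i p + z) (sym (δ-≢ (≢-sym i≢a)))))))
    lemma : ∀ v x → v - x + 1ℚ + x ≡ v + 1ℚ
    lemma = solve-∀ ℚ-ring

another-block : ∀ {v lam} {B : Blocks v} → IsRyser v lam B → ∀ a → ∃ λ b → b ≢ a
another-block {B = B} ry a with IsRyser.twoSizes ry
... | i , j , ki≢kj with i ≟ a
...   | no i≢a   = i , i≢a
...   | yes refl = j , λ j≡i → ki≢kj (cong (λ x → ∣ B x ∣) (sym j≡i))

point-inside : ∀ {v lam} {B : Blocks v} → IsRyser v lam B → ∀ a → ∃ λ p → lookup (B a) p ≡ true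
point-inside {B = B} ry a = member (B a) (ℕP.≤-<-trans z≤n (IsRyser.bigBlocks ry a))

point-outside : ∀ {v lam} {B : Blocks v} → IsRyser v lam B → ∀ a b → b ≢ a → ∃ λ q → lookup (B a) q ≡ false
point-outside {lam = lam} {B = B} ry a b b≢a with full-or-missing (B a)
... | inj₁ missing = missing
... | inj₂ full    = ⊥-elim (ℕP.<-irrefl (sym Bb≡lam) (IsRyser.bigBlocks ry b))
  where
  Bb≡lam : ∣ B b ∣ ≡ lam
  Bb≡lam = trans (cong ∣_∣ (sym (full-∩ (B a) (B b) full))) (IsRyser.meet ry a b (≢-sym b≢a))

type1-if-k≡2lam : ∀ {v lam} {B : Blocks v} → IsRyser v lam B →
  ∀ a k → (∀ i → i ≢ a → ∣ B i ∣ ≡ k) → ∣ B a ∣ ≢ k → k ≡ 2 ℕ.* lam → IsType1 B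
type1-if-k≡2lam {v} {lam} {B} ry a k others Ba≢k k≡2lam =
  K , μ , D , a , Perm.id , derived-symmetric k≡2lam , K≢2μ , sym (derived-self B a) , recover
  where
  open Derived B ry a k others
  -- K = 2 (K − lam) would give K = 2 lam = k.
  K≢2μ : K ≢ 2 ℕ.* μ
  K≢2μ K≡2μ = Ba≢k (↑-injective (trans (lemma (↑ K) (↑ lam) (trans (cong ↑ K≡2μ) (trans (↑-double μ) (cong ((1ℚ + 1ℚ) *_) ↑μ))))
                                       (sym (trans (cong ↑ k≡2lam) (↑-double lam)))))
    where
    lemma : ∀ K l → K ≡ (1ℚ + 1ℚ) * (K - l) → K ≡ (1ℚ + 1ℚ) * l
    lemma K l eq = sym (trans (lemma₁ K l) (trans (cong (λ z → (1ℚ + 1ℚ) * K - z) (sym eq)) (lemma₂ K)))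
      where
      lemma₁ : ∀ K l → (1ℚ + 1ℚ) * l ≡ (1ℚ + 1ℚ) * K - (1ℚ + 1ℚ) * (K - l)
      lemma₁ = solve-∀ ℚ-ring
      lemma₂ : ∀ K → (1ℚ + 1ℚ) * K - K ≡ K
      lemma₂ = solve-∀ ℚ-ring

-- When k ≠ 2 lam and the replication numbers take two values summing to
-- v + 1, we reach a contradiction: the derived family is a Ryser design
-- with the same exceptional block a.  Separation in B gives p ∈ B a and
-- q ∉ B a with r p + r q = v + 1, so in the derived family r′ p = v + 1 − r p
-- = r q = r′ q, contradicting separation there.
k≢2lam-impossible : ∀ {v lam} {B : Blocks v} → IsRyser v lam B →
  ∀ {r₁ r₂} → r₁ ℕ.+ r₂ ≡ suc v → (∀ p → rep B p ≡ r₁ ⊎ rep B p ≡ r₂) →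
  ∀ a k → (∀ i → i ≢ a → ∣ B i ∣ ≡ k) → ∣ B a ∣ ≢ k → k ≢ 2 ℕ.* lam → ⊥
k≢2lam-impossible {v} {lam} {B} ry {r₁} {r₂} r₁+r₂ reps a k others Ba≢k k≢2lam =
  separation (derived-ryser b b≢a k≢2lam) a b D-same D-differ p q
    (trans (cong (λ X → lookup X p) (derived-self B a)) p∈a)
    (trans (cong (λ X → lookup X q) (derived-self B a)) q∉a)
    rep-D-equal
  where
  open Derived B ry a k others
  b : Fin v
  b = proj₁ (another-block ry a)
  b≢a : b ≢ a
  b≢a = proj₂ (another-block ry a)
  p q : Fin v
  p = proj₁ (point-inside ry a)
  q = proj₁ (point-outside ry a b b≢a)
  p∈a : lookup (B a) p ≡ true
  p∈a = proj₂ (point-inside ry a)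
  q∉a : lookup (B a) q ≡ false
  q∉a = proj₂ (point-outside ry a b b≢a)
  B-differ : rep B p ≢ rep B q
  B-differ = separation ry a b (λ i i≢a → trans (others i i≢a) (sym (others b b≢a))) (λ eq → Ba≢k (trans eq (others b b≢a)))
                        p q p∈a q∉a
  rep-sum : rep B q ℕ.+ rep B p ≡ suc v
  rep-sum with reps p | reps q
  ... | inj₁ rp≡r₁ | inj₁ rq≡r₁ = ⊥-elim (B-differ (trans rp≡r₁ (sym rq≡r₁)))
  ... | inj₁ rp≡r₁ | inj₂ rq≡r₂ = trans (cong₂ ℕ._+_ rq≡r₂ rp≡r₁) (trans (ℕP.+-comm r₂ r₁) r₁+r₂)
  ... | inj₂ rp≡r₂ | inj₁ rq≡r₁ = trans (cong₂ ℕ._+_ rq≡r₁ rp≡r₂) r₁+r₂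
  ... | inj₂ rp≡r₂ | inj₂ rq≡r₂ = ⊥-elim (B-differ (trans rp≡r₂ (sym rq≡r₂)))
  rep-D-equal : rep D p ≡ rep D q
  rep-D-equal = trans (ℕP.+-cancelʳ-≡ (rep B p) _ _ (trans (rep-inside p p∈a) (sym rep-sum))) (sym (rep-outside q q∉a))
  size-D : ∀ {i} → i ≢ a → ↑ ∣ D i ∣ ≡ ↑ K + ↑ k - (1ℚ + 1ℚ) * ↑ lam
  size-D i≢a = trans (cong (λ X → ↑ ∣ X ∣) (derived-other B i≢a)) (size-other i≢a)
  D-same : ∀ i → i ≢ a → ∣ D i ∣ ≡ ∣ D b ∣
  D-same i i≢a = ↑-injective (trans (size-D i≢a) (sym (size-D b≢a)))
  D-differ : ∣ D a ∣ ≢ ∣ D b ∣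
  D-differ = proj₂ (proj₂ (IsRyser.twoSizes (derived-ryser b b≢a k≢2lam)))

type1-criterion : ∀ {v lam} {B : Blocks v} → IsRyser v lam B →
  ∀ {r₁ r₂} → r₁ ℕ.+ r₂ ≡ suc v → (∀ p → rep B p ≡ r₁ ⊎ rep B p ≡ r₂) →
  ∀ a k → (∀ i → i ≢ a → ∣ B i ∣ ≡ k) → ∣ B a ∣ ≢ k → IsType1 B
type1-criterion {lam = lam} ry r₁+r₂ reps a k others Ba≢k with k ℕ.≟ 2 ℕ.* lam
... | yes k≡2lam = type1-if-k≡2lam ry a k others Ba≢k k≡2lam
... | no k≢2lam  = ⊥-elim (k≢2lam-impossible ry r₁+r₂ reps a k others Ba≢k k≢2lam)

module ReplicationCounting {v lam : ℕ} (B : Blocks v) (ry : IsRyser v lam B)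
  {r₁ r₂ : ℕ} (r₂<r₁ : r₂ ℕ.< r₁) (r₁+r₂ : r₁ ℕ.+ r₂ ≡ suc v)
  (reps : ∀ p → rep B p ≡ r₁ ⊎ rep B p ≡ r₂)
  {c d : ℕ} (coprime : Coprime c d) (cd : c ℕ.* (r₂ ℕ.∸ 1) ≡ d ℕ.* (r₁ ℕ.∸ 1)) where

  open IsRyser ry
  open RyserIncidence B ry using (N; size; meetℚ; rep≡r) renaming (d to excess; gram to gramℚ)

  r₁≢r₂ : r₁ ≢ r₂
  r₁≢r₂ r₁≡r₂ = ℕP.<-irrefl (sym r₁≡r₂) r₂<r₁

  E₁ E₂ : Fin v → Bool
  E₁ p = ⌊ rep B p ℕ.≟ r₁ ⌋
  E₂ p = ⌊ rep B p ℕ.≟ r₂ ⌋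

  χE₁ : ∀ p → χ (E₁ p) ≡ 1ℚ - χ (E₂ p)
  χE₁ p with rep B p ℕ.≟ r₁ | rep B p ℕ.≟ r₂ | reps p
  ... | yes rp≡r₁ | yes rp≡r₂ | _ = ⊥-elim (r₁≢r₂ (trans (sym rp≡r₁) rp≡r₂))
  ... | yes _     | no _      | _ = refl
  ... | no _      | yes _     | _ = refl
  ... | no rp≢r₁  | no _      | inj₁ rp≡r₁ = ⊥-elim (rp≢r₁ rp≡r₁)
  ... | no _      | no rp≢r₂  | inj₂ rp≡r₂ = ⊥-elim (rp≢r₂ rp≡r₂)

  rep-split : ∀ p → ↑ (rep B p) ≡ ↑ r₁ + χ (E₂ p) * (↑ r₂ - ↑ r₁)
  rep-split p with rep B p ℕ.≟ r₂ | reps p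
  ... | yes rp≡r₂ | _          = trans (cong ↑ rp≡r₂) (lemma (↑ r₁) (↑ r₂))
    where
    lemma : ∀ a b → b ≡ a + 1ℚ * (b - a)
    lemma = solve-∀ ℚ-ring
  ... | no rp≢r₂  | inj₁ rp≡r₁ = trans (cong ↑ rp≡r₁) (lemma (↑ r₁) (↑ r₂))
    where
    lemma : ∀ a b → a ≡ a + 0ℚ * (b - a)
    lemma = solve-∀ ℚ-ring
  ... | no rp≢r₂  | inj₂ rp≡r₂ = ⊥-elim (rp≢r₂ rp≡r₂)

  β α : Fin v → ℚ
  β i = sum (λ p → N i p * χ (E₂ p))
  α i = sum (λ p → N i p * χ (E₁ p))

  α≡size-β : ∀ i → α i ≡ ↑ ∣ B i ∣ - β i
  α≡size-β i = trans (sum-cong-≗ (λ p → trans (cong (N i p *_) (χE₁ p)) (lemma (N i p) (χ (E₂ p)))))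
                     (trans (sum-- {v} _ _) (cong (_- β i) (size i)))
    where
    lemma : ∀ a b → a * (1ℚ - b) ≡ a - a * b
    lemma = solve-∀ ℚ-ring

  -- Both replication numbers are at least 1: a point of any block has
  -- positive replication, and no point lies in all v + 1 "blocks".
  r₂≥1 : 1 ℕ.≤ r₂
  r₂≥1 with r₂ ℕ.≟ 0
  ... | no r₂≢0 = ℕP.n≢0⇒n>0 r₂≢0
  ... | yes r₂≡0 with twoSizes
  ...   | a , _ with point-inside ry a
  ...     | p , p∈a with reps p
  ...       | inj₂ rp≡r₂ = ⊥-elim (QP.<-irrefl refl (QP.<-≤-trans (QP.positive⁻¹ 1ℚ) 1≤rp))
    where
    1≤rp : 1ℚ ≤ 0ℚ
    1≤rp = subst₂ _≤_ (cong χ p∈a) (trans (sym (rep≡r p)) (cong ↑ (trans rp≡r₂ r₂≡0)))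
             (summand≤sum (λ i → N i p) (λ i → χ-nonneg (lookup (B i) p)) a)
  ...       | inj₁ rp≡r₁ = ⊥-elim (ℕP.<-irrefl refl (ℕP.≤-trans (s≤s (∣p∣≤n (tabulate (λ i → lookup (B i) p))))
                              (ℕP.≤-reflexive (sym (trans rp≡r₁ r₁≡1+v)))))
    where
    r₁≡1+v : r₁ ≡ suc v
    r₁≡1+v = trans (sym (ℕP.+-identityʳ r₁)) (trans (cong (r₁ ℕ.+_) (sym r₂≡0)) r₁+r₂)

  r₁≥1 : 1 ℕ.≤ r₁
  r₁≥1 = ℕP.≤-trans r₂≥1 (ℕP.<⇒≤ r₂<r₁)

  R₁ R₂ : ℚ
  R₁ = ↑ r₁ - 1ℚ
  R₂ = ↑ r₂ - 1ℚ

  cR₂≡dR₁ : ↑ c * R₂ ≡ ↑ d * R₁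
  cR₂≡dR₁ = begin
    ↑ c * R₂                  ≡⟨ cong (↑ c *_) (sym (↑-∸ r₂≥1)) ⟩
    ↑ c * ↑ (r₂ ℕ.∸ 1)        ≡⟨ sym (↑-* c (r₂ ℕ.∸ 1)) ⟩
    ↑ (c ℕ.* (r₂ ℕ.∸ 1))      ≡⟨ cong ↑ cd ⟩
    ↑ (d ℕ.* (r₁ ℕ.∸ 1))      ≡⟨ ↑-* d (r₁ ℕ.∸ 1) ⟩
    ↑ d * ↑ (r₁ ℕ.∸ 1)        ≡⟨ cong (↑ d *_) (↑-∸ r₁≥1) ⟩
    ↑ d * R₁                  ∎
    where open ≡-Reasoning

  R₁+R₂ : R₁ + R₂ ≡ ↑ v - 1ℚ
  R₁+R₂ = begin
    (↑ r₁ - 1ℚ) + (↑ r₂ - 1ℚ)       ≡⟨ lemma (↑ r₁) (↑ r₂) ⟩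
    (↑ r₁ + ↑ r₂) - (1ℚ + 1ℚ)       ≡⟨ cong (_- (1ℚ + 1ℚ)) (sym (trans (sym (↑-suc v)) (trans (cong ↑ (sym r₁+r₂)) (↑-+ r₁ r₂)))) ⟩
    (↑ v + 1ℚ) - (1ℚ + 1ℚ)          ≡⟨ lemma′ (↑ v) ⟩
    ↑ v - 1ℚ                        ∎
    where
    open ≡-Reasoning
    lemma : ∀ a b → (a - 1ℚ) + (b - 1ℚ) ≡ (a + b) - (1ℚ + 1ℚ)
    lemma = solve-∀ ℚ-ring
    lemma′ : ∀ a → (a + 1ℚ) - (1ℚ + 1ℚ) ≡ a - 1ℚ
    lemma′ = solve-∀ ℚ-ring

  R₁≢0 : R₁ ≢ 0ℚ
  R₁≢0 R₁≡0 = ℕP.<-irrefl refl (ℕP.<-≤-trans (subst (r₂ ℕ.<_) r₁≡1 r₂<r₁) r₂≥1)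
    where
    r₁≡1 : r₁ ≡ 1
    r₁≡1 = trans (sym (ℕP.m∸n+n≡m r₁≥1)) (cong (ℕ._+ 1) (↑-injective (trans (↑-∸ r₁≥1) R₁≡0)))

  -- a = c − d is nonzero: c = d forces r₁ = r₂ (or c = d = 0, not coprime).
  c-d≢0 : ↑ c - ↑ d ≢ 0ℚ
  c-d≢0 c-d≡0 = c≢d (↑-injective (x-y≡0⇒x≡y (↑ c) (↑ d) c-d≡0))
    where
    c≢d : c ≢ d
    c≢d = helper c d coprime cd
      where
      helper : ∀ c d → Coprime c d → c ℕ.* (r₂ ℕ.∸ 1) ≡ d ℕ.* (r₁ ℕ.∸ 1) → c ≢ d
      helper zero    .zero    cop _  refl with cop {2} (2 ∣0 , 2 ∣0)
      ... | ()
      helper (suc c) .(suc c) _   eq refl = r₁≢r₂ (sym (begin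
        r₂                    ≡⟨ sym (ℕP.m∸n+n≡m r₂≥1) ⟩
        r₂ ℕ.∸ 1 ℕ.+ 1        ≡⟨ cong (ℕ._+ 1) (ℕP.*-cancelˡ-≡ (r₂ ℕ.∸ 1) (r₁ ℕ.∸ 1) (suc c) eq) ⟩
        r₁ ℕ.∸ 1 ℕ.+ 1        ≡⟨ ℕP.m∸n+n≡m r₁≥1 ⟩
        r₁                    ∎))
        where open ≡-Reasoning

  -- Σ_{p ∈ B i} r p = v lam + (|B i| − lam): every other block meets B i in lam points.
  weighted-replication : ∀ i → sum (λ p → N i p * ↑ (rep B p)) ≡ ↑ v * ↑ lam + excess i
  weighted-replication i = begin
    sum (λ p → N i p * ↑ (rep B p))                ≡⟨ sum-cong-≗ (λ p → cong (N i p *_) (rep≡r p)) ⟩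
    sum (λ p → N i p * sum (λ l → N l p))          ≡⟨ sum-interchange (N i) (λ p l → N l p) ⟩
    sum (λ l → sum (λ p → N i p * N l p))          ≡⟨ sum-cong-≗ (gramℚ i) ⟩
    sum (λ l → ↑ lam + δ i l * excess i)           ≡⟨ ∑-distrib-+ {v} _ _ ⟩
    sum {v} (λ _ → ↑ lam) + sum (λ l → δ i l * excess i)
                                                   ≡⟨ cong₂ _+_ (sum-const {v} (↑ lam)) (sum-δ i (λ _ → excess i)) ⟩
    ↑ v * ↑ lam + excess i                         ∎
    where open ≡-Reasoning

  block-equation : ∀ i → R₁ * ↑ ∣ B i ∣ + (↑ r₂ - ↑ r₁) * β i ≡ (↑ v - 1ℚ) * ↑ lam
  block-equation i = begin
    R₁ * ↑ ∣ B i ∣ + (↑ r₂ - ↑ r₁) * β i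
      ≡⟨ cong₂ _+_ (cong (R₁ *_) (sym (size i))) (sym (sum-*ˡ {v} (↑ r₂ - ↑ r₁) _)) ⟩
    R₁ * sum (N i) + sum (λ p → (↑ r₂ - ↑ r₁) * (N i p * χ (E₂ p)))
      ≡⟨ cong (_+ sum (λ p → (↑ r₂ - ↑ r₁) * (N i p * χ (E₂ p)))) (sym (sum-*ˡ {v} R₁ (N i))) ⟩
    sum (λ p → R₁ * N i p) + sum (λ p → (↑ r₂ - ↑ r₁) * (N i p * χ (E₂ p)))
      ≡⟨ sym (∑-distrib-+ {v} _ _) ⟩
    sum (λ p → R₁ * N i p + (↑ r₂ - ↑ r₁) * (N i p * χ (E₂ p)))
      ≡⟨ sum-cong-≗ (λ p → trans (lemma (N i p) (↑ r₁) (↑ r₂) (χ (E₂ p))) (cong (λ z → N i p * z - N i p) (sym (rep-split p)))) ⟩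
    sum (λ p → N i p * ↑ (rep B p) - N i p)
      ≡⟨ sum-- {v} _ _ ⟩
    sum (λ p → N i p * ↑ (rep B p)) - sum (N i)
      ≡⟨ cong₂ _-_ (weighted-replication i) (size i) ⟩
    ↑ v * ↑ lam + (↑ ∣ B i ∣ - ↑ lam) - ↑ ∣ B i ∣
      ≡⟨ lemma′ (↑ v) (↑ lam) (↑ ∣ B i ∣) ⟩
    (↑ v - 1ℚ) * ↑ lam ∎
    where
    open ≡-Reasoning
    lemma : ∀ x a b e → (a - 1ℚ) * x + (b - a) * (x * e) ≡ x * (a + e * (b - a)) - x
    lemma = solve-∀ ℚ-ring
    lemma′ : ∀ V l s → V * l + (s - l) - s ≡ (V - 1ℚ) * l
    lemma′ = solve-∀ ℚ-ring

  β-formula : ∀ i T → ↑ ∣ B i ∣ ≡ (1ℚ + 1ℚ) * ↑ lam + T * (↑ c - ↑ d) → β i ≡ ↑ lam + T * ↑ c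
  β-formula i T size≡ = sym (x-y≡0⇒x≡y _ _ Y≡0)
    where
    C D L b s : ℚ
    C = ↑ c
    D = ↑ d
    L = ↑ lam
    b = β i
    s = ↑ ∣ B i ∣
    -- X = c s + (d − c) b − (c + d) lam vanishes after multiplying by r₁ − 1.
    R₁X : R₁ * (C * s + (D - C) * b - (C + D) * L) ≡ 0ℚ
    R₁X = begin
      R₁ * (C * s + (D - C) * b - (C + D) * L)
        ≡⟨ identity C D (↑ r₁) (↑ r₂) s b L ⟩
      C * (R₁ * s + (↑ r₂ - ↑ r₁) * b - (R₁ + R₂) * L) - (C * R₂ - D * R₁) * (b - L)
        ≡⟨ cong₂ (λ x y → C * (x - (R₁ + R₂) * L) - y * (b - L)) (block-equation i)
             (trans (cong (λ z → C * R₂ - z) (sym cR₂≡dR₁)) (QP.+-inverseʳ (C * R₂))) ⟩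
      C * ((↑ v - 1ℚ) * L - (R₁ + R₂) * L) - 0ℚ * (b - L)
        ≡⟨ cong (λ x → C * ((↑ v - 1ℚ) * L - x * L) - 0ℚ * (b - L)) R₁+R₂ ⟩
      C * ((↑ v - 1ℚ) * L - (↑ v - 1ℚ) * L) - 0ℚ * (b - L)
        ≡⟨ vanish C (↑ v) L b ⟩
      0ℚ ∎
      where
      open ≡-Reasoning
      identity : ∀ c d r₁ r₂ s b l → (r₁ - 1ℚ) * (c * s + (d - c) * b - (c + d) * l)
        ≡ c * ((r₁ - 1ℚ) * s + (r₂ - r₁) * b - ((r₁ - 1ℚ) + (r₂ - 1ℚ)) * l) - (c * (r₂ - 1ℚ) - d * (r₁ - 1ℚ)) * (b - l)
      identity = solve-∀ ℚ-ring
      vanish : ∀ c V l b → c * ((V - 1ℚ) * l - (V - 1ℚ) * l) - 0ℚ * (b - l) ≡ 0ℚ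
      vanish = solve-∀ ℚ-ring
    X≡0 : C * s + (D - C) * b - (C + D) * L ≡ 0ℚ
    X≡0 = *-cancelˡ-≢0 R₁ R₁≢0 (trans R₁X (sym (QP.*-zeroʳ R₁)))
    lemma₁ : ∀ c d l t b → (c - d) * ((l + t * c) - b) ≡ c * ((1ℚ + 1ℚ) * l + t * (c - d)) + (d - c) * b - (c + d) * l
    lemma₁ = solve-∀ ℚ-ring
    Y≡0 : (L + T * C) - b ≡ 0ℚ
    Y≡0 = *-cancelˡ-≢0 (C - D) c-d≢0 (begin
      (C - D) * ((L + T * C) - b)                                   ≡⟨ lemma₁ C D L T b ⟩
      C * ((1ℚ + 1ℚ) * L + T * (C - D)) + (D - C) * b - (C + D) * L  ≡⟨ cong (λ z → C * z + (D - C) * b - (C + D) * L) (sym size≡) ⟩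
      C * s + (D - C) * b - (C + D) * L                             ≡⟨ X≡0 ⟩
      0ℚ                                                            ≡⟨ sym (QP.*-zeroʳ (C - D)) ⟩
      (C - D) * 0ℚ                                                  ∎)
      where open ≡-Reasoning

  α-formula : ∀ i T → ↑ ∣ B i ∣ ≡ (1ℚ + 1ℚ) * ↑ lam + T * (↑ c - ↑ d) → α i ≡ ↑ lam - T * ↑ d
  α-formula i T size≡ = trans (α≡size-β i) (trans (cong₂ _-_ size≡ (β-formula i T size≡)) (lemma (↑ lam) T (↑ c) (↑ d)))
    where
    lemma : ∀ l t c d → ((1ℚ + 1ℚ) * l + t * (c - d)) - (l + t * c) ≡ l - t * d
    lemma = solve-∀ ℚ-ring

  pair-bound : ∀ (F : Fin v → Bool) i j → i ≢ j →
    sum (λ p → N i p * χ (F p)) + sum (λ p → N j p * χ (F p)) - ↑ lam ≤ sum (λ p → χ (F p))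
  pair-bound F i j i≢j = begin
    sum (λ p → N i p * χ (F p)) + sum (λ p → N j p * χ (F p)) - ↑ lam
      ≡⟨ cong₂ _-_ (sym (∑-distrib-+ {v} _ _)) (sym (meetℚ i j i≢j)) ⟩
    sum (λ p → N i p * χ (F p) + N j p * χ (F p)) - sum (λ p → N i p * N j p)
      ≤⟨ QP.+-monoʳ-≤ (sum (λ p → N i p * χ (F p) + N j p * χ (F p)))
           (QP.neg-antimono-≤ (sum-mono-≤ _ _ (λ p → inter≤ (F p) (lookup (B i) p) (lookup (B j) p)))) ⟩
    sum (λ p → N i p * χ (F p) + N j p * χ (F p)) - sum (λ p → χ (F p) * (N i p * N j p))
      ≡⟨ sym (sum-- {v} _ _) ⟩
    sum (λ p → N i p * χ (F p) + N j p * χ (F p) - χ (F p) * (N i p * N j p))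
      ≤⟨ sum-mono-≤ _ _ (λ p → union≤ (F p) (lookup (B i) p) (lookup (B j) p)) ⟩
    sum (λ p → χ (F p)) ∎
    where
    open QP.≤-Reasoning
    inter≤ : ∀ f x y → χ f * (χ x * χ y) ≤ χ x * χ y
    inter≤ true  x y = QP.≤-reflexive (QP.*-identityˡ _)
    inter≤ false x y = subst (_≤ χ x * χ y) (sym (QP.*-zeroˡ (χ x * χ y))) (subst (0ℚ ≤_) (χ-∧ x y) (χ-nonneg (x ∧ y)))
    union≤ : ∀ f x y → χ x * χ f + χ y * χ f - χ f * (χ x * χ y) ≤ χ f
    union≤ false x y = QP.≤-reflexive (lemma (χ x) (χ y))
      where
      lemma : ∀ a b → a * 0ℚ + b * 0ℚ - 0ℚ * (a * b) ≡ 0ℚ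
      lemma = solve-∀ ℚ-ring
    union≤ true true  true  = QP.≤-refl
    union≤ true true  false = QP.≤-refl
    union≤ true false true  = QP.≤-refl
    union≤ true false false = χ-nonneg true

  unique-size-by-E₂ : ∀ T → ↑ (numRep B r₂) < ↑ lam + (1ℚ + 1ℚ) * T * ↑ c →
    ∀ i j → ↑ ∣ B i ∣ ≡ (1ℚ + 1ℚ) * ↑ lam + T * (↑ c - ↑ d) → ↑ ∣ B j ∣ ≡ (1ℚ + 1ℚ) * ↑ lam + T * (↑ c - ↑ d) → i ≡ j
  unique-size-by-E₂ T e₂< i j size-i size-j with i ≟ j
  ... | yes i≡j = i≡j
  ... | no i≢j  = ⊥-elim (QP.<-irrefl refl (QP.<-≤-trans e₂< (subst₂ _≤_
          (trans (cong₂ (λ x y → x + y - ↑ lam) (β-formula i T size-i) (β-formula j T size-j)) (lemma (↑ lam) T (↑ c)))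
          (sym (card-tabulate E₂)) (pair-bound E₂ i j i≢j))))
    where
    lemma : ∀ l t c → (l + t * c) + (l + t * c) - l ≡ l + (1ℚ + 1ℚ) * t * c
    lemma = solve-∀ ℚ-ring

  unique-size-by-E₁ : ∀ T → ↑ (numRep B r₁) < ↑ lam - (1ℚ + 1ℚ) * T * ↑ d →
    ∀ i j → ↑ ∣ B i ∣ ≡ (1ℚ + 1ℚ) * ↑ lam + T * (↑ c - ↑ d) → ↑ ∣ B j ∣ ≡ (1ℚ + 1ℚ) * ↑ lam + T * (↑ c - ↑ d) → i ≡ j
  unique-size-by-E₁ T e₁< i j size-i size-j with i ≟ j
  ... | yes i≡j = i≡j
  ... | no i≢j  = ⊥-elim (QP.<-irrefl refl (QP.<-≤-trans e₁< (subst₂ _≤_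
          (trans (cong₂ (λ x y → x + y - ↑ lam) (α-formula i T size-i) (α-formula j T size-j)) (lemma (↑ lam) T (↑ d)))
          (sym (card-tabulate E₁)) (pair-bound E₁ i j i≢j))))
    where
    lemma : ∀ l t d → (l - t * d) + (l - t * d) - l ≡ l - (1ℚ + 1ℚ) * t * d
    lemma = solve-∀ ℚ-ring

open import Data.Integer using (+_)

size-in-ℚ : ∀ {k} lam c d t → + k ≡ + 2 ℤ.* + lam ℤ.+ t ℤ.* (+ c ℤ.- + d) →
  ↑ k ≡ (1ℚ + 1ℚ) * ↑ lam + fromℤ t * (↑ c - ↑ d)
size-in-ℚ {k} lam c d t eq = begin
  ↑ k                                                       ≡⟨ cong fromℤ eq ⟩
  fromℤ (+ 2 ℤ.* + lam ℤ.+ t ℤ.* (+ c ℤ.- + d))             ≡⟨ fromℤ-+ (+ 2 ℤ.* + lam) (t ℤ.* (+ c ℤ.- + d)) ⟩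
  fromℤ (+ 2 ℤ.* + lam) + fromℤ (t ℤ.* (+ c ℤ.- + d))       ≡⟨ cong₂ _+_ (trans (fromℤ-* (+ 2) (+ lam)) (cong (_* ↑ lam) (↑-+ 1 1)))
                                                                        (trans (fromℤ-* t (+ c ℤ.- + d)) (cong (fromℤ t *_) (fromℤ-- (+ c) (+ d)))) ⟩
  (1ℚ + 1ℚ) * ↑ lam + fromℤ t * (↑ c - ↑ d)                 ∎
  where open ≡-Reasoning

size-in-ℚ⁻ : ∀ {k} lam c d t → + k ≡ + 2 ℤ.* + lam ℤ.- t ℤ.* (+ c ℤ.- + d) →
  ↑ k ≡ (1ℚ + 1ℚ) * ↑ lam + (- fromℤ t) * (↑ c - ↑ d)
size-in-ℚ⁻ {k} lam c d t eq = begin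
  ↑ k                                                       ≡⟨ cong fromℤ eq ⟩
  fromℤ (+ 2 ℤ.* + lam ℤ.- t ℤ.* (+ c ℤ.- + d))             ≡⟨ fromℤ-- (+ 2 ℤ.* + lam) (t ℤ.* (+ c ℤ.- + d)) ⟩
  fromℤ (+ 2 ℤ.* + lam) - fromℤ (t ℤ.* (+ c ℤ.- + d))       ≡⟨ cong₂ _-_ (trans (fromℤ-* (+ 2) (+ lam)) (cong (_* ↑ lam) (↑-+ 1 1)))
                                                                        (trans (fromℤ-* t (+ c ℤ.- + d)) (cong (fromℤ t *_) (fromℤ-- (+ c) (+ d)))) ⟩
  (1ℚ + 1ℚ) * ↑ lam - fromℤ t * (↑ c - ↑ d)                 ≡⟨ lemma (↑ lam) (fromℤ t) (↑ c - ↑ d) ⟩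
  (1ℚ + 1ℚ) * ↑ lam + (- fromℤ t) * (↑ c - ↑ d)             ∎
  where
  open ≡-Reasoning
  lemma : ∀ l t a → (1ℚ + 1ℚ) * l - t * a ≡ (1ℚ + 1ℚ) * l + (- t) * a
  lemma = solve-∀ ℚ-ring

bound-in-ℚ : ∀ {e} lam c t → + e ℤ.< + 2 ℤ.* t ℤ.* + c ℤ.+ + lam → ↑ e < ↑ lam + (1ℚ + 1ℚ) * fromℤ t * ↑ c
bound-in-ℚ {e} lam c t e< = subst (↑ e <_) (begin
  fromℤ (+ 2 ℤ.* t ℤ.* + c ℤ.+ + lam)             ≡⟨ fromℤ-+ (+ 2 ℤ.* t ℤ.* + c) (+ lam) ⟩
  fromℤ (+ 2 ℤ.* t ℤ.* + c) + ↑ lam               ≡⟨ cong (_+ ↑ lam) (trans (fromℤ-* (+ 2 ℤ.* t) (+ c)) (cong (_* ↑ c) (trans (fromℤ-* (+ 2) t) (cong (_* fromℤ t) (↑-+ 1 1))))) ⟩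
  (1ℚ + 1ℚ) * fromℤ t * ↑ c + ↑ lam               ≡⟨ QP.+-comm ((1ℚ + 1ℚ) * fromℤ t * ↑ c) (↑ lam) ⟩
  ↑ lam + (1ℚ + 1ℚ) * fromℤ t * ↑ c               ∎) (fromℤ-< e<)
  where open ≡-Reasoning

other-blocks : ∀ {v} {B : Blocks v} {k k′} → (∀ i → ∣ B i ∣ ≡ k′ ⊎ ∣ B i ∣ ≡ k) →
  ∀ a → (∀ i → ∣ B i ∣ ≡ k′ → i ≡ a) → ∀ i → i ≢ a → ∣ B i ∣ ≡ k
other-blocks sizes a only-a i i≢a with sizes i
... | inj₁ Bi≡k′ = ⊥-elim (i≢a (only-a i Bi≡k′))
... | inj₂ Bi≡k  = Bi≡k

-- Theorem 1.13.  (a) If k₁ = 2 lam + t₁ (c − d) with e₂ < 2 t₁ c + lam, then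
-- B i₁ is the only block of size k₁ (two such blocks would contain at least
-- lam + 2 t₁ c points of replication r₂), so the Type-1 criterion applies
-- with exceptional block i₁.  (b) Symmetrically, with t = −t₂, the bound on
-- e₁ leaves B i₂ as the only block of size k₂.
theorem1p13 :
    ∀ (v lam : ℕ) (B : Blocks v) → IsRyser v lam B →
    ∀ (r₁ r₂ : ℕ) → r₂ ℕ.< r₁ → r₁ ℕ.+ r₂ ≡ suc v →
    (∀ p → rep B p ≡ r₁ ⊎ rep B p ≡ r₂) →
    ∀ (k₁ k₂ : ℕ) → k₂ ℕ.< k₁ →
    (∀ i → ∣ B i ∣ ≡ k₁ ⊎ ∣ B i ∣ ≡ k₂) →
    (∃[ i ] ∣ B i ∣ ≡ k₁) → (∃[ i ] ∣ B i ∣ ≡ k₂) →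
    ∀ (c d : ℕ) → Coprime c d → c ℕ.* (r₂ ℕ.∸ 1) ≡ d ℕ.* (r₁ ℕ.∸ 1) →
    ( (∀ (t₁ : ℤ) →
         + k₁ ≡ (+ 2) ℤ.* (+ lam) ℤ.+ t₁ ℤ.* ((+ c) ℤ.- (+ d)) →
         + numRep B r₂ ℤ.< (+ 2) ℤ.* t₁ ℤ.* (+ c) ℤ.+ (+ lam) →
         IsType1 B)
    × (∀ (t₂ : ℤ) →
         + k₂ ≡ (+ 2) ℤ.* (+ lam) ℤ.- t₂ ℤ.* ((+ c) ℤ.- (+ d)) →
         + numRep B r₁ ℤ.< (+ 2) ℤ.* t₂ ℤ.* (+ d) ℤ.+ (+ lam) →
         IsType1 B) )
theorem1p13 v lam B ry r₁ r₂ r₂<r₁ r₁+r₂ reps k₁ k₂ k₂<k₁ sizes (i₁ , size-i₁) (i₂ , size-i₂) c d coprime cd =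
    (λ t₁ k₁≡ e₂< → type1-criterion ry r₁+r₂ reps i₁ k₂
                      (other-blocks {B = B} sizes i₁ (only-i₁ t₁ k₁≡ e₂<)) (λ eq → k₁≢k₂ (trans (sym size-i₁) eq)))
  , (λ t₂ k₂≡ e₁< → type1-criterion ry r₁+r₂ reps i₂ k₁
                      (other-blocks {B = B} (λ i → swap (sizes i)) i₂ (only-i₂ t₂ k₂≡ e₁<)) (λ eq → k₁≢k₂ (sym (trans (sym size-i₂) eq))))
  where
  open ReplicationCounting B ry r₂<r₁ r₁+r₂ reps coprime cd

  k₁≢k₂ : k₁ ≢ k₂
  k₁≢k₂ k₁≡k₂ = ℕP.<-irrefl (sym k₁≡k₂) k₂<k₁

  only-i₁ : ∀ t₁ → + k₁ ≡ (+ 2) ℤ.* (+ lam) ℤ.+ t₁ ℤ.* ((+ c) ℤ.- (+ d)) →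
            + numRep B r₂ ℤ.< (+ 2) ℤ.* t₁ ℤ.* (+ c) ℤ.+ (+ lam) → ∀ i → ∣ B i ∣ ≡ k₁ → i ≡ i₁
  only-i₁ t₁ k₁≡ e₂< i size-i = unique-size-by-E₂ (fromℤ t₁) (bound-in-ℚ lam c t₁ e₂<) i i₁
    (trans (cong ↑ size-i) (size-in-ℚ lam c d t₁ k₁≡)) (trans (cong ↑ size-i₁) (size-in-ℚ lam c d t₁ k₁≡))

  only-i₂ : ∀ t₂ → + k₂ ≡ (+ 2) ℤ.* (+ lam) ℤ.- t₂ ℤ.* ((+ c) ℤ.- (+ d)) →
            + numRep B r₁ ℤ.< (+ 2) ℤ.* t₂ ℤ.* (+ d) ℤ.+ (+ lam) → ∀ i → ∣ B i ∣ ≡ k₂ → i ≡ i₂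
  only-i₂ t₂ k₂≡ e₁< i size-i = unique-size-by-E₁ (- fromℤ t₂) e₁<ℚ i i₂
    (trans (cong ↑ size-i) (size-in-ℚ⁻ lam c d t₂ k₂≡)) (trans (cong ↑ size-i₂) (size-in-ℚ⁻ lam c d t₂ k₂≡))
    where
    flip-sign : ∀ l t d → l + (1ℚ + 1ℚ) * t * d ≡ l - (1ℚ + 1ℚ) * (- t) * d
    flip-sign = solve-∀ ℚ-ring
    e₁<ℚ : ↑ (numRep B r₁) < ↑ lam - (1ℚ + 1ℚ) * (- fromℤ t₂) * ↑ d
    e₁<ℚ = subst (↑ (numRep B r₁) <_) (flip-sign (↑ lam) (fromℤ t₂) (↑ d)) (bound-in-ℚ lam d t₂ e₁<)
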